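{- Consider a depth-first exploration of a finite directed graph with $\mathit{pre}$ and $\mathit{low}$ values, augmented with the component-finding computation described in the context. Suppose that for each vertex $v$, at the moment $v$ is postvisited, $v.\mathit{low}$ has the correct value, namely the minimum of $w.\mathit{pre}$ over all vertices $w$ reachable from $v$ by a retreating path all of whose vertices lie in the strong component of $v$. Then the component-finding computation maintains the following invariant: for every vertex $v$ (from its previsit on), $v.\mathit{low}=\infty$ if and only if the leader of the strong component containing $v$ has been postvisited.
   Context: Loops and parallel arcs are allowed. Two vertices are mutually reachable if each is reachable from the other; the equivalence classes are the strong components. A depth-first exploration proceeds as follows. Initially all vertices are unvisited, all arcs untraversed, and the current vertex is null. Repeat the applicable case until all vertices are visited and all arcs are traversed: (i) The current vertex is null and some vertex is unvisited: choose any unvisited $v$, make it current and visit it; $v$ is a root. (ii) The current vertex $v$ has an untraversed exiting arc: choose any such arc $a$, from $v$ to $w$, and advance on it. If $w$ is visited, immediately retreat on $a$. Otherwise $a$ becomes a tree arc, $w$ becomes current and is visited. (iii) The current vertex $v$ has no untraversed exiting arc: if $v$ is a root, the current vertex becomes null; otherwise retreat on the tree arc entering $v$, from $u$ say, and make $u$ current. The first visit of $v$ is its previsit, at which $v.\mathit{pre}$ is set to the next integer $1,2,\dots$ and $v.\mathit{low}$ is initialized to $v.\mathit{pre}$. The step (iii) at which $v$ is current with no untraversed exiting arc is its postvisit. A directed path is retreating if the exploration retreats on its arcs in the reverse of their order along the path; a path with no arcs is retreating. The leader of a strong component is its vertex with minimum $\mathit{pre}$. The component-finding computation uses a stack $F$,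 initially empty. At the postvisit of $v$: - If $v.\mathit{low}\neq v.\mathit{pre}$, push $v$ onto $F$. - Otherwise, repeatedly pop the top vertex $x$ of $F$, while $F$ is nonempty and $x.\mathit{low}\ge v.\mathit{low}$, and set $x.\mathit{low}\gets\infty$. Then set $v.\mathit{low}\gets\infty$. The popped vertices together with $v$ are reported as the component of $v$. Here $\infty$ exceeds every integer. -}

module Defs where

open import Data.Nat using (ℕ; zero; suc; _≤_; _<_; _>_; _≤ᵇ_; _≡ᵇ_)
open import Data.Fin using (Fin; _≟_)
open import Data.Bool using (Bool; true; false; if_then_else_)
open import Data.Maybe using (Maybe; just; nothing)
open import Data.List using (List; []; _∷_; map)
open import Data.List.Relation.Unary.All using (All)
open import Data.List.Relation.Unary.Linked using (Linked)
open import Data.List.Relation.Binary.Pointwise using (Pointwise)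
open import Data.Product using (Σ; ∃; _×_; _,_)
open import Data.Empty using (⊥)
open import Relation.Nullary.Decidable using (⌊_⌋)
open import Relation.Binary.PropositionalEquality using (_≡_)

record Graph : Set where
  field
    n : ℕ
    m : ℕ
    tl : Fin m → Fin n
    hd : Fin m → Fin n

data Low : Set where
  fin : ℕ → Low
  ∞   : Low

minL : Low → Low → Low
minL (fin a) (fin b) = if a ≤ᵇ b then fin a else fin b
minL (fin a) ∞       = fin a
minL ∞       y       = y

geqL : Low → Low → Bool
geqL ∞       _       = true
geqL (fin _) ∞       = false
geqL (fin a) (fin b) = b ≤ᵇ a

eqLP : Low → ℕ → Bool
eqLP (fin a) p = a ≡ᵇ p
eqLP ∞       p = false

module _ {n : ℕ} {A : Set} where
  upd : (Fin n → A) → Fin n → A → Fin n → A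
  upd f x y u = if ⌊ u ≟ x ⌋ then y else f u

module _ (G : Graph) where
  open Graph G

  data Reach : Fin n → Fin n → Set where
    here  : ∀ {v} → Reach v v
    there : ∀ {v w} (a : Fin m) → tl a ≡ v → Reach (hd a) w → Reach v w

  Mutual : Fin n → Fin n → Set
  Mutual u v = Reach u v × Reach v u

  data Path : Fin n → Fin n → List (Fin m) → Set where
    []  : ∀ {v} → Path v v []
    _∷_ : ∀ {v w a as} → tl a ≡ v → Path (hd a) w as → Path v w (a ∷ as)

  record State : Set where
    field
      visited   : Fin n → Bool
      done      : Fin n → Bool          -- postvisited
      pre       : Fin n → ℕ
      low       : Fin n → Low
      traversed : Fin m → Bool
      current   : Maybe (Fin n)
      parent    : Fin n → Maybe (Fin m) -- tree arc entering the vertex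
      counter   : ℕ                     -- last pre number handed out
      F         : List (Fin n)
  open State public

  initial : State
  initial = record
    { visited = λ _ → false ; done = λ _ → false ; pre = λ _ → 0
    ; low = λ _ → fin 0 ; traversed = λ _ → false ; current = nothing
    ; parent = λ _ → nothing ; counter = 0 ; F = [] }

  Terminal : State → Set
  Terminal s = (current s ≡ nothing) × (∀ v → visited s v ≡ true)
             × (∀ a → traversed s a ≡ true)

  previsit : State → Fin n → Maybe (Fin m) → State
  previsit s w p = record s
    { visited = upd (visited s) w true
    ; pre     = upd (pre s) w (suc (counter s))
    ; low     = upd (low s) w (fin (suc (counter s)))
    ; counter = suc (counter s)
    ; parent  = upd (parent s) w p
    ; current = just w }

  popLoop : (Fin n → Low) → Low → List (Fin n) → (Fin n → Low) × List (Fin n)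
  popLoop L b []      = L , []
  popLoop L b (x ∷ xs) =
    if geqL (L x) b then popLoop (upd L x ∞) b xs else (L , x ∷ xs)

  postF : State → Fin n → State
  postF s v =
    if eqLP (low s v) (pre s v)
    then (let r = popLoop (low s) (low s v) (F s)
          in record s { low = upd (Data.Product.proj₁ r) v ∞
                      ; F = Data.Product.proj₂ r ; done = upd (done s) v true })
    else record s { F = v ∷ F s ; done = upd (done s) v true }

  data Label : Set where
    root      : Fin n → Label
    tree      : Fin m → Label
    nontree   : Fin m → Label            -- case (ii), w visited: advance and retreat
    postRoot  : Fin n → Label
    postChild : Fin n → Fin m → Label    -- case (iii), retreat on tree arc a entering v

  AllExitTraversed : State → Fin n → Set
  AllExitTraversed s v = ∀ a → tl a ≡ v → traversed s a ≡ true

  Step : State → Label → State → Set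
  Step s (root v) s' =
    (current s ≡ nothing) × (visited s v ≡ false) × (s' ≡ previsit s v nothing)
  Step s (tree a) s' =
    (current s ≡ just (tl a)) × (traversed s a ≡ false) × (visited s (hd a) ≡ false)
    × (s' ≡ previsit (record s { traversed = upd (traversed s) a true }) (hd a) (just a))
  Step s (nontree a) s' =
    (current s ≡ just (tl a)) × (traversed s a ≡ false) × (visited s (hd a) ≡ true)
    × (s' ≡ record s { traversed = upd (traversed s) a true
                     ; low = upd (low s) (tl a) (minL (low s (tl a)) (low s (hd a))) })
  Step s (postRoot v) s' =
    (current s ≡ just v) × AllExitTraversed s v × (parent s v ≡ nothing)
    × (s' ≡ record (postF s v) { current = nothing })
  Step s (postChild v a) s' =
    (current s ≡ just v) × AllExitTraversed s v × (parent s v ≡ just a)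
    × (s' ≡ let t = postF s v in
             record t { current = just (tl a)
                      ; low = upd (low t) (tl a) (minL (low t (tl a)) (low t v)) })

  -- a complete exploration: states st 0 .. st len, labels lbl 0 .. lbl (len-1)
  record Run : Set where
    field
      len    : ℕ
      st     : ℕ → State
      lbl    : ℕ → Label
      start  : st 0 ≡ initial
      steps  : ∀ i → i < len → Step (st i) (lbl i) (st (suc i))
      finish : Terminal (st len)
  open Run public

  Postvisits : Label → Fin n → Set
  Postvisits (postRoot v)    u = v ≡ u
  Postvisits (postChild v _) u = v ≡ u
  Postvisits _               _ = ⊥

  Retreats : Label → Fin m → Set
  Retreats (nontree a)     b = a ≡ b
  Retreats (postChild _ a) b = a ≡ b
  Retreats _               _ = ⊥

  module _ (R : Run) where
    finalPre : Fin n → ℕ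
    finalPre = pre (st R (len R))

    RetreatsAt : Fin m → ℕ → Set
    RetreatsAt a t = (t < len R) × Retreats (lbl R t) a

    RetReach : Fin n → Fin n → Set
    RetReach v w = Σ (List (Fin m)) λ as → Path v w as
      × All (Mutual v) (map hd as)
      × Σ (List ℕ) λ ts → Pointwise RetreatsAt as ts × Linked _>_ ts

    CorrectLow : Fin n → Low → Set
    CorrectLow v x = Σ ℕ λ k → (x ≡ fin k)
      × (Σ (Fin n) λ w → RetReach v w × finalPre w ≡ k)
      × (∀ w → RetReach v w → k ≤ finalPre w)

    LowCorrectAtPostvisits : Set
    LowCorrectAtPostvisits = ∀ i → i < len R → ∀ v → Postvisits (lbl R i) v →
      CorrectLow v (low (st R i) v)

    IsLeader : Fin n → Fin n → Set
    IsLeader ℓ v = Mutual ℓ v × (∀ w → Mutual w v → finalPre ℓ ≤ finalPre w)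

{-# OPTIONS --safe #-}
module Submission where

-- Two invariants hold along the run. The structural one says that the visited but unfinished
-- vertices form the tree path from the current vertex to a root, with pre increasing along it. The
-- component invariant says that low = ∞ exactly for the vertices whose leader is postvisited, and
-- that F holds the other postvisited vertices, each with low equal to the pre number of an earlier
-- vertex of its component; moreover, for every unfinished vertex u the vertices of F visited after
-- u form a prefix of F.
--
-- The only delicate step is a postvisit of v with low = pre. Then v is the leader of its component:
-- otherwise, on a path from v to an earlier vertex of the component, take the first arc leaving the
-- vertices visited since v; the tree path from v to its tail, followed by that arc, is a retreating
-- path inside the component to a vertex with smaller pre. Every other vertex of the component is
-- then finished, and those with finite low are exactly the vertices of F visited after v, which the
-- popping loop removes.

open import Defs
open import Data.Bool using (Bool; true; false)
open import Data.Bool.Properties using (T-≡; ⇔→≡) renaming (_≟_ to _≟ᵇ_)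
open import Data.Empty using (⊥; ⊥-elim)
open import Data.Fin using (Fin; _≟_)
open import Data.List using (List; []; _∷_; map)
open import Data.List.Membership.Propositional using (_∈_)
import Data.List.Relation.Unary.Any as Any
open import Data.List.Relation.Unary.All as All using (All; []; _∷_)
open import Data.List.Relation.Unary.Linked as Linked using (Linked; []; [-]; _∷_)
open import Data.List.Relation.Binary.Pointwise using (Pointwise; []; _∷_)
open import Data.Maybe as Maybe using (Maybe; just; nothing)
open import Data.Maybe.Properties using (just-injective)
open import Data.Nat using (ℕ; zero; suc; _≤_; _<_; _>_; _≤ᵇ_; _<ᵇ_; z≤n; s≤s; s≤s⁻¹; _≤?_; _<?_)
open import Data.Nat.Properties hiding (_≟_)
open import Data.Product using (Σ; ∃; _×_; _,_; proj₁; proj₂)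
open import Data.Sum using (_⊎_; inj₁; inj₂; [_,_]′)
open import Data.Unit using (⊤; tt)
open import Function.Bundles using (_⇔_; mk⇔; Equivalence)
open import Relation.Nullary using (¬_; Dec; yes; no)
open import Relation.Nullary.Decidable using (_×-dec_)
open import Relation.Binary.PropositionalEquality using (_≡_; _≢_; refl; sym; trans; cong; subst; subst₂)

true≢false : true ≢ false
true≢false ()

nothing≢just : ∀ {A : Set} {x : A} → nothing ≢ just x
nothing≢just ()

∞≢fin : ∀ {k} → ∞ ≢ fin k
∞≢fin ()

fin-injective : ∀ {a b} → fin a ≡ fin b → a ≡ b
fin-injective refl = refl

minL-fin : ∀ a x → ∃ λ k → minL (fin a) x ≡ fin k
minL-fin a ∞ = a , refl
minL-fin a (fin b) with a ≤ᵇ b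
... | true = a , refl
... | false = b , refl

finite⇒≢∞ : ∀ {x k} → x ≡ fin k → x ≢ ∞
finite⇒≢∞ x≡ x≡∞ = ∞≢fin (trans (sym x≡∞) x≡)

minL-finite : ∀ x y → x ≢ ∞ → minL x y ≢ ∞
minL-finite (fin a) y _ = finite⇒≢∞ (proj₂ (minL-fin a y))
minL-finite ∞ y x≢∞ = ⊥-elim (x≢∞ refl)

eqLP⇒≡fin : ∀ x p → eqLP x p ≡ true → x ≡ fin p
eqLP⇒≡fin (fin a) p e = cong fin (≡ᵇ⇒≡ a p (Equivalence.from T-≡ e))

eqLP-false⇒≢ : ∀ k p → eqLP (fin k) p ≡ false → k ≢ p
eqLP-false⇒≢ k p e k≡p = true≢false (trans (sym (Equivalence.to T-≡ (≡⇒≡ᵇ k p k≡p))) e)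

geqL-fin : ∀ a b c → (b ≤ a → b < c) → (b < c → b ≤ a) → geqL (fin a) (fin b) ≡ (b <ᵇ c)
geqL-fin a b c to from = ⇔→≡ (mk⇔
  (λ e → Equivalence.to T-≡ (<⇒<ᵇ (to (≤ᵇ⇒≤ b a (Equivalence.from T-≡ e)))))
  (λ e → Equivalence.to T-≡ (≤⇒≤ᵇ (from (<ᵇ⇒< b c (Equivalence.from T-≡ e))))))

<ᵇ-true : ∀ {m n} → m < n → (m <ᵇ n) ≡ true
<ᵇ-true m<n = Equivalence.to T-≡ (<⇒<ᵇ m<n)

<ᵇ-true⇒< : ∀ {m n} → (m <ᵇ n) ≡ true → m < n
<ᵇ-true⇒< {m} {n} e = <ᵇ⇒< m n (Equivalence.from T-≡ e)

<ᵇ-false : ∀ {m n} → n ≤ m → (m <ᵇ n) ≡ false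
<ᵇ-false {m} {n} n≤m with m <ᵇ n in e
... | true = ⊥-elim (<⇒≱ (<ᵇ-true⇒< e) n≤m)
... | false = refl

module _ {n : ℕ} {A : Set} where
  upd-≡ : (f : Fin n → A) (x : Fin n) (y : A) → upd f x y x ≡ y
  upd-≡ f x y with x ≟ x
  ... | yes _ = refl
  ... | no x≢x = ⊥-elim (x≢x refl)

  upd-≢ : (f : Fin n → A) (x : Fin n) (y : A) (u : Fin n) → u ≢ x → upd f x y u ≡ f u
  upd-≢ f x y u u≢x with u ≟ x
  ... | yes u≡x = ⊥-elim (u≢x u≡x)
  ... | no _ = refl

upd-keeps-true : ∀ {n} (f : Fin n → Bool) x u → f u ≡ true → upd f x true u ≡ true
upd-keeps-true f x u e with u ≟ x
... | yes _ = refl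
... | no _ = e

upd-still-false : ∀ {n} (f : Fin n → Bool) x u → upd f x true u ≡ false → u ≢ x × f u ≡ false
upd-still-false f x u e with u ≟ x
... | yes _ = ⊥-elim (true≢false e)
... | no u≢x = u≢x , e

-- the elements satisfying p form a prefix of the list
PrefixClosed : {A : Set} → (A → Bool) → List A → Set
PrefixClosed p [] = ⊤
PrefixClosed p (x ∷ xs) = (p x ≡ false → All (λ y → p y ≡ false) xs) × PrefixClosed p xs

all-false⇒PrefixClosed : ∀ {A : Set} {p : A → Bool} xs → All (λ y → p y ≡ false) xs → PrefixClosed p xs
all-false⇒PrefixClosed [] [] = tt
all-false⇒PrefixClosed (x ∷ xs) (_ ∷ fs) = (λ _ → fs) , all-false⇒PrefixClosed xs fs

interval-induction : (P : ℕ → Set) {i L : ℕ} → P i → (∀ k → i ≤ k → k < L → P k → P (suc k)) →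
  ∀ j → i ≤ j → j ≤ L → P j
interval-induction P base step zero z≤n _ = base
interval-induction P base step (suc j) i≤1+j 1+j≤L with m≤n⇒m<n∨m≡n i≤1+j
... | inj₁ i<1+j =
  step j (s≤s⁻¹ i<1+j) 1+j≤L (interval-induction P base step j (s≤s⁻¹ i<1+j) (<⇒≤ 1+j≤L))
... | inj₂ refl = base

rising-edge : (p : ℕ → Bool) {i j : ℕ} → i ≤ j → p i ≡ false → p j ≡ true →
  ∃ λ k → i ≤ k × k < j × p k ≡ false × p (suc k) ≡ true
rising-edge p {j = zero} z≤n pi pj = ⊥-elim (true≢false (trans (sym pj) pi))
rising-edge p {j = suc j} i≤1+j pi pj with m≤n⇒m<n∨m≡n i≤1+j | p j in pj'
... | inj₂ refl | _ = ⊥-elim (true≢false (trans (sym pj) pi))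
... | inj₁ i<1+j | false = j , s≤s⁻¹ i<1+j , ≤-refl , pj' , pj
... | inj₁ i<1+j | true with rising-edge p (s≤s⁻¹ i<1+j) pi pj'
...   | k , i≤k , k<j , pk , pk+1 = k , i≤k , m<n⇒m<1+n k<j , pk , pk+1

module _ {G : Graph} where
  open Graph G

  Reach-trans : ∀ {x y z} → Reach G x y → Reach G y z → Reach G x z
  Reach-trans here q = q
  Reach-trans (there a e r) q = there a e (Reach-trans r q)

  Mutual-sym : ∀ {x y} → Mutual G x y → Mutual G y x
  Mutual-sym (xy , yx) = yx , xy

  Mutual-trans : ∀ {x y z} → Mutual G x y → Mutual G y z → Mutual G x z
  Mutual-trans (xy , yx) (yz , zy) = Reach-trans xy yz , Reach-trans zy yx

  Reach-exit : (P : Fin n → Set) → (∀ y → Dec (P y)) → ∀ {x w} → P x → ¬ P w → Reach G x w →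
    Σ (Fin m) λ b → P (tl b) × ¬ P (hd b) × Reach G x (tl b) × Reach G (hd b) w
  Reach-exit P P? px ¬pw here = ⊥-elim (¬pw px)
  Reach-exit P P? px ¬pw (there b refl r) with P? (hd b)
  ... | no ¬pb = b , px , ¬pb , here , r
  ... | yes pb with Reach-exit P P? pb ¬pw r
  ...   | c , pc , ¬pc , bc , cw = c , pc , ¬pc , there b refl bc , cw

  Path-in-component : ∀ {v x z as} → Path G x z as → All (Mutual G v) (map hd as) → x ≡ z ⊎ Mutual G v z
  Path-in-component [] [] = inj₁ refl
  Path-in-component (_ ∷ p) (m ∷ ms) with Path-in-component p ms
  ... | inj₁ refl = inj₂ m
  ... | inj₂ q = inj₂ q

  leader-self : ∀ {R ℓ v} → IsLeader G R ℓ v → IsLeader G R ℓ ℓ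
  leader-self (ℓv , min) = (here , here) , λ w wℓ → min w (Mutual-trans wℓ ℓv)

module Exploration (G : Graph) where
  open Graph G

  report : State G → Fin n → State G
  report s v = record s
    { low  = upd (proj₁ (popLoop G (low s) (low s v) (F s))) v ∞
    ; F    = proj₂ (popLoop G (low s) (low s v) (F s))
    ; done = upd (done s) v true }

  push : State G → Fin n → State G
  push s v = record s { F = v ∷ F s ; done = upd (done s) v true }

  leaveRoot : State G → State G
  leaveRoot t = record t { current = nothing }

  returnAlong : State G → Fin n → Fin m → State G
  returnAlong t v a = record t
    { current = just (tl a) ; low = upd (low t) (tl a) (minL (low t (tl a)) (low t v)) }

  postF-report-or-push : ∀ s v →
    (eqLP (low s v) (pre s v) ≡ true × postF G s v ≡ report s v)
    ⊎ (eqLP (low s v) (pre s v) ≡ false × postF G s v ≡ push s v)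
  postF-report-or-push s v with eqLP (low s v) (pre s v)
  ... | true = inj₁ (refl , refl)
  ... | false = inj₂ (refl , refl)

  data StepView (s : State G) : Label G → State G → Set where
    rootStep    : ∀ v → current s ≡ nothing → visited s v ≡ false →
                  StepView s (root v) (previsit G s v nothing)
    treeStep    : ∀ a → current s ≡ just (tl a) → traversed s a ≡ false → visited s (hd a) ≡ false →
                  StepView s (tree a)
                    (previsit G (record s { traversed = upd (traversed s) a true }) (hd a) (just a))
    nontreeStep : ∀ a → current s ≡ just (tl a) → traversed s a ≡ false → visited s (hd a) ≡ true →
                  StepView s (nontree a) (record s
                    { traversed = upd (traversed s) a true
                    ; low = upd (low s) (tl a) (minL (low s (tl a)) (low s (hd a))) })
    rootReport  : ∀ v → current s ≡ just v → AllExitTraversed G s v → parent s v ≡ nothing →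
                  eqLP (low s v) (pre s v) ≡ true → StepView s (postRoot v) (leaveRoot (report s v))
    rootPush    : ∀ v → current s ≡ just v → AllExitTraversed G s v → parent s v ≡ nothing →
                  eqLP (low s v) (pre s v) ≡ false → StepView s (postRoot v) (leaveRoot (push s v))
    childReport : ∀ v a → current s ≡ just v → AllExitTraversed G s v → parent s v ≡ just a →
                  eqLP (low s v) (pre s v) ≡ true → StepView s (postChild v a) (returnAlong (report s v) v a)
    childPush   : ∀ v a → current s ≡ just v → AllExitTraversed G s v → parent s v ≡ just a →
                  eqLP (low s v) (pre s v) ≡ false → StepView s (postChild v a) (returnAlong (push s v) v a)

  step⇒view : ∀ {s l s'} → Step G s l s' → StepView s l s'
  step⇒view {l = root v} (c , nv , refl) = rootStep v c nv
  step⇒view {l = tree a} (c , t , nv , refl) = treeStep a c t nv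
  step⇒view {l = nontree a} (c , t , vh , refl) = nontreeStep a c t vh
  step⇒view {s} {l = postRoot v} (c , ae , p , refl) with postF-report-or-push s v
  ... | inj₁ (e , q) = subst (λ t → StepView s (postRoot v) (leaveRoot t)) (sym q) (rootReport v c ae p e)
  ... | inj₂ (e , q) = subst (λ t → StepView s (postRoot v) (leaveRoot t)) (sym q) (rootPush v c ae p e)
  step⇒view {s} {l = postChild v a} (c , ae , p , refl) with postF-report-or-push s v
  ... | inj₁ (e , q) = subst (λ t → StepView s (postChild v a) (returnAlong t v a)) (sym q) (childReport v a c ae p e)
  ... | inj₂ (e , q) = subst (λ t → StepView s (postChild v a) (returnAlong t v a)) (sym q) (childPush v a c ae p e)

  Active : State G → Fin n → Set
  Active s x = visited s x ≡ true × done s x ≡ false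

  -- a path of the depth-first tree, listed from its deepest vertex up to a root
  data TreePath (s : State G) : List (Fin n) → Set where
    rootPath  : ∀ {x} → parent s x ≡ nothing → TreePath s (x ∷ [])
    childPath : ∀ {x y S} a → parent s x ≡ just a → tl a ≡ y → hd a ≡ x →
                pre s y < pre s x → TreePath s (y ∷ S) → TreePath s (x ∷ y ∷ S)

  TreePath-below : ∀ {s c S x} → TreePath s (c ∷ S) → x ∈ S → pre s x < pre s c
  TreePath-below (childPath a _ _ _ y<c _) (Any.here refl) = y<c
  TreePath-below (childPath a _ _ _ y<c p) (Any.there x∈) = <-trans (TreePath-below p x∈) y<c

  TreePath-pre : ∀ {s c S x} → TreePath s (c ∷ S) → x ∈ c ∷ S → pre s x ≤ pre s c
  TreePath-pre p (Any.here refl) = ≤-refl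
  TreePath-pre p (Any.there x∈) = <⇒≤ (TreePath-below p x∈)

  TreePath-reach : ∀ {s c S x} → TreePath s (c ∷ S) → x ∈ c ∷ S → Reach G x c
  TreePath-reach p (Any.here refl) = here
  TreePath-reach {c = c} (childPath a _ ta ha _ p) (Any.there x∈) =
    Reach-trans (TreePath-reach p x∈) (there a ta (subst (λ z → Reach G z c) (sym ha) here))

  TreePath-stable : ∀ {s s' S} → (∀ x → x ∈ S → pre s' x ≡ pre s x × parent s' x ≡ parent s x) →
    TreePath s S → TreePath s' S
  TreePath-stable same (rootPath p) = rootPath (trans (proj₂ (same _ (Any.here refl))) p)
  TreePath-stable {s} {s'} same (childPath {x} {y} a p ta ha y<x t) =
    childPath a (trans (proj₂ (same x (Any.here refl))) p) ta ha
      (subst₂ _<_ (sym (proj₁ (same y (Any.there (Any.here refl))))) (sym (proj₁ (same x (Any.here refl)))) y<x)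
      (TreePath-stable (λ z z∈ → same z (Any.there z∈)) t)

  parent-on-path : ∀ {s v a S} → TreePath s (v ∷ S) → parent s v ≡ just a → tl a ∈ S
  parent-on-path (rootPath p) q = ⊥-elim (nothing≢just (trans (sym p) q))
  parent-on-path (childPath b p tb _ _ _) q with just-injective (trans (sym p) q)
  ... | refl = Any.here tb

  record ActivePath (s : State G) (c : Fin n) : Set where
    field
      below      : List (Fin n)
      complete   : ∀ x → Active s x → x ∈ c ∷ below
      sound      : ∀ x → x ∈ c ∷ below → Active s x
      isTreePath : TreePath s (c ∷ below)

  record Invariant (s : State G) : Set where
    field
      done⇒visited      : ∀ x → done s x ≡ true → visited s x ≡ true
      pre≤counter       : ∀ x → visited s x ≡ true → pre s x ≤ counter s
      pre-injective     : ∀ x y → visited s x ≡ true → visited s y ≡ true → pre s x ≡ pre s y → x ≡ y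
      traversed⇒visited : ∀ a → traversed s a ≡ true → visited s (hd a) ≡ true
      done⇒traversed    : ∀ x → done s x ≡ true → AllExitTraversed G s x
      idle⇒inactive     : current s ≡ nothing → ∀ x → ¬ Active s x
      activePath        : ∀ {c} → current s ≡ just c → ActivePath s c
      F⇒done            : ∀ x → x ∈ F s → done s x ≡ true
      active⇒finite     : ∀ x → Active s x → ∃ λ k → low s x ≡ fin k
  open Invariant

  invariant-initial : Invariant (initial G)
  invariant-initial = record
    { done⇒visited = λ x () ; pre≤counter = λ x () ; pre-injective = λ x y () ; traversed⇒visited = λ a ()
    ; done⇒traversed = λ x () ; idle⇒inactive = λ { _ x (() , _) } ; activePath = λ ()
    ; F⇒done = λ x () ; active⇒finite = λ x _ → 0 , refl }

  module _ {s : State G} (I : Invariant s) where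
    current-active : ∀ {c} → current s ≡ just c → Active s c
    current-active c≡ = ActivePath.sound (activePath I c≡) _ (Any.here refl)

    active-pre≤current : ∀ {c x} → current s ≡ just c → Active s x → pre s x ≤ pre s c
    active-pre≤current c≡ ax = TreePath-pre isTreePath (complete _ ax)
      where open ActivePath (activePath I c≡)

    active-reaches-current : ∀ {c x} → current s ≡ just c → Active s x → Reach G x c
    active-reaches-current c≡ ax = TreePath-reach isTreePath (complete _ ax)
      where open ActivePath (activePath I c≡)

    active-above-current : ∀ {c x} → current s ≡ just c → Active s x → pre s c ≤ pre s x → x ≡ c
    active-above-current c≡ ax c≤x = pre-injective I _ _ (proj₁ ax) (proj₁ (current-active c≡))
      (≤-antisym (active-pre≤current c≡ ax) c≤x)

    unvisited⇒undone : ∀ {x} → visited s x ≡ false → done s x ≡ false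
    unvisited⇒undone {x} nv with done s x in dx
    ... | true = ⊥-elim (true≢false (trans (sym (done⇒visited I x dx)) nv))
    ... | false = refl

    parent-active : ∀ {v a} → current s ≡ just v → parent s v ≡ just a → Active s (tl a) × tl a ≢ v
    parent-active {a = a} c≡ p =
      sound _ (Any.there tl∈) , λ e → <-irrefl (cong (pre s) e) (TreePath-below isTreePath tl∈)
      where
      open ActivePath (activePath I c≡)
      tl∈ : tl a ∈ below
      tl∈ = parent-on-path isTreePath p

    F⇒visited : ∀ x → x ∈ F s → visited s x ≡ true
    F⇒visited x x∈ = done⇒visited I x (F⇒done I x x∈)

    active∉F : ∀ {x} → Active s x → ¬ (x ∈ F s)
    active∉F ax x∈ = true≢false (trans (sym (F⇒done I _ x∈)) (proj₂ ax))

    Above : Fin n → Fin n → Set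
    Above c y = visited s y ≡ true × pre s c ≤ pre s y

    Above? : ∀ c y → Dec (Above c y)
    Above? c y = (visited s y ≟ᵇ true) ×-dec (pre s c ≤? pre s y)

    above-finished : ∀ {c y} → current s ≡ just c → Above c y → y ≡ c ⊎ done s y ≡ true
    above-finished {c} {y} c≡ (vy , c≤y) with done s y in dy
    ... | true = inj₂ refl
    ... | false = inj₁ (active-above-current c≡ (vy , dy) c≤y)

    ExitArc : Fin n → Fin n → Fin n → Set
    ExitArc c x w = Σ (Fin m) λ b → Above c (tl b) × traversed s b ≡ true × pre s (hd b) < pre s c
                                    × Reach G x (tl b) × Reach G (hd b) w

    -- at the postvisit of c, every arc leaving a vertex above c has been traversed
    exit-below : ∀ {c x w} → current s ≡ just c → AllExitTraversed G s c →
      Above c x → ¬ Above c w → Reach G x w → ExitArc c x w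
    exit-below {c} c≡ ae ax ¬aw xw with Reach-exit (Above c) (Above? c) ax ¬aw xw
    ... | b , ab , ¬ahd , xb , bw = b , ab , traversed-b , ≰⇒> (λ c≤hd → ¬ahd (vhd , c≤hd)) , xb , bw
      where
      traversed-b : traversed s b ≡ true
      traversed-b with above-finished c≡ ab
      ... | inj₁ tl≡c = ae b tl≡c
      ... | inj₂ d = done⇒traversed I _ d b refl
      vhd : visited s (hd b) ≡ true
      vhd = traversed⇒visited I b traversed-b

  previsit-invariant : ∀ s tr w p → Invariant s → visited s w ≡ false →
    (∀ a → tr a ≡ true → traversed s a ≡ true ⊎ hd a ≡ w) →
    (∀ a → traversed s a ≡ true → tr a ≡ true) →
    ActivePath (previsit G (record s { traversed = tr }) w p) w →
    Invariant (previsit G (record s { traversed = tr }) w p)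
  previsit-invariant s tr w p I nw new-arcs old-arcs path = record
    { done⇒visited = λ x d → upd-keeps-true (visited s) w x (done⇒visited I x d)
    ; pre≤counter = pre≤counter'
    ; pre-injective = pre-injective'
    ; traversed⇒visited = traversed⇒visited'
    ; done⇒traversed = λ x d a e → old-arcs a (done⇒traversed I x d a e)
    ; idle⇒inactive = λ ()
    ; activePath = λ { refl → path }
    ; F⇒done = F⇒done I
    ; active⇒finite = active⇒finite' }
    where
    s' : State G
    s' = previsit G (record s { traversed = tr }) w p
    pre≤counter' : ∀ x → visited s' x ≡ true → pre s' x ≤ suc (counter s)
    pre≤counter' x vx with x ≟ w
    ... | yes _ = ≤-refl
    ... | no _ = m≤n⇒m≤1+n (pre≤counter I x vx)
    pre-injective' : ∀ x y → visited s' x ≡ true → visited s' y ≡ true → pre s' x ≡ pre s' y → x ≡ y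
    pre-injective' x y vx vy e with x ≟ w | y ≟ w
    ... | yes x≡w | yes y≡w = trans x≡w (sym y≡w)
    ... | yes _ | no _ = ⊥-elim (1+n≰n (≤-trans (≤-reflexive e) (pre≤counter I y vy)))
    ... | no _ | yes _ = ⊥-elim (1+n≰n (≤-trans (≤-reflexive (sym e)) (pre≤counter I x vx)))
    ... | no _ | no _ = pre-injective I x y vx vy e
    traversed⇒visited' : ∀ a → tr a ≡ true → visited s' (hd a) ≡ true
    traversed⇒visited' a t with new-arcs a t
    ... | inj₁ old = upd-keeps-true (visited s) w (hd a) (traversed⇒visited I a old)
    ... | inj₂ refl = upd-≡ (visited s) (hd a) true
    active⇒finite' : ∀ x → Active s' x → ∃ λ k → low s' x ≡ fin k
    active⇒finite' x ax with x ≟ w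
    ... | yes _ = suc (counter s) , refl
    ... | no _ = active⇒finite I x ax

  root-invariant : ∀ s v → Invariant s → current s ≡ nothing → visited s v ≡ false →
    Invariant (previsit G s v nothing)
  root-invariant s v I idle nv = previsit-invariant s (traversed s) v nothing I nv
    (λ a t → inj₁ t) (λ a t → t) path
    where
    s' : State G
    s' = previsit G s v nothing
    complete : ∀ x → Active s' x → x ∈ v ∷ []
    complete x ax with x ≟ v
    ... | yes x≡v = Any.here x≡v
    ... | no _ = ⊥-elim (idle⇒inactive I idle x ax)
    path : ActivePath s' v
    path = record
      { below = [] ; complete = complete
      ; sound = λ { x (Any.here refl) → upd-≡ (visited s) v true , unvisited⇒undone I nv }
      ; isTreePath = rootPath (upd-≡ (parent s) v nothing) }

  tree-invariant : ∀ s a → Invariant s → current s ≡ just (tl a) → visited s (hd a) ≡ false →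
    Invariant (previsit G (record s { traversed = upd (traversed s) a true }) (hd a) (just a))
  tree-invariant s a I c≡ nv = previsit-invariant s (upd (traversed s) a true) (hd a) (just a) I nv
    new-arcs (λ b t → upd-keeps-true (traversed s) a b t) path
    where
    s' : State G
    s' = previsit G (record s { traversed = upd (traversed s) a true }) (hd a) (just a)
    open ActivePath (activePath I c≡)
    new-arcs : ∀ b → upd (traversed s) a true b ≡ true → traversed s b ≡ true ⊎ hd b ≡ hd a
    new-arcs b t with b ≟ a
    ... | yes refl = inj₂ refl
    ... | no _ = inj₁ t
    old : ∀ x → x ∈ tl a ∷ below → x ≢ hd a
    old x x∈ refl = true≢false (trans (sym (proj₁ (sound x x∈))) nv)
    same : ∀ x → x ∈ tl a ∷ below → pre s' x ≡ pre s x × parent s' x ≡ parent s x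
    same x x∈ = upd-≢ (pre s) (hd a) _ x (old x x∈) , upd-≢ (parent s) (hd a) _ x (old x x∈)
    tl<hd : pre s' (tl a) < pre s' (hd a)
    tl<hd = subst₂ _<_ (sym (proj₁ (same (tl a) (Any.here refl)))) (sym (upd-≡ (pre s) (hd a) _))
              (s≤s (pre≤counter I (tl a) (proj₁ (current-active I c≡))))
    complete' : ∀ x → Active s' x → x ∈ hd a ∷ tl a ∷ below
    complete' x ax with x ≟ hd a
    ... | yes x≡hd = Any.here x≡hd
    ... | no _ = Any.there (complete x ax)
    sound' : ∀ x → x ∈ hd a ∷ tl a ∷ below → Active s' x
    sound' x (Any.here refl) = upd-≡ (visited s) (hd a) true , unvisited⇒undone I nv
    sound' x (Any.there x∈) = upd-keeps-true (visited s) (hd a) x (proj₁ (sound x x∈)) , proj₂ (sound x x∈)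
    path : ActivePath s' (hd a)
    path = record
      { below = tl a ∷ below ; complete = complete' ; sound = sound'
      ; isTreePath = childPath a (upd-≡ (parent s) (hd a) (just a)) refl refl tl<hd
                       (TreePath-stable same isTreePath) }

  nontree-invariant : ∀ s a → Invariant s → current s ≡ just (tl a) → visited s (hd a) ≡ true →
    Invariant (record s { traversed = upd (traversed s) a true
                        ; low = upd (low s) (tl a) (minL (low s (tl a)) (low s (hd a))) })
  nontree-invariant s a I c≡ vh = record
    { done⇒visited = done⇒visited I ; pre≤counter = pre≤counter I ; pre-injective = pre-injective I
    ; traversed⇒visited = traversed⇒visited'
    ; done⇒traversed = λ x d b e → upd-keeps-true (traversed s) a b (done⇒traversed I x d b e)
    ; idle⇒inactive = idle⇒inactive I
    ; activePath = λ c≡' → let open ActivePath (activePath I c≡') in record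
        { below = below ; complete = complete ; sound = sound
        ; isTreePath = TreePath-stable (λ _ _ → refl , refl) isTreePath }
    ; F⇒done = F⇒done I
    ; active⇒finite = active⇒finite' }
    where
    traversed⇒visited' : ∀ b → upd (traversed s) a true b ≡ true → visited s (hd b) ≡ true
    traversed⇒visited' b t with b ≟ a
    ... | yes refl = vh
    ... | no _ = traversed⇒visited I b t
    active⇒finite' : ∀ x → Active s x →
      ∃ λ k → upd (low s) (tl a) (minL (low s (tl a)) (low s (hd a))) x ≡ fin k
    active⇒finite' x ax with x ≟ tl a
    ... | no _ = active⇒finite I x ax
    ... | yes refl with active⇒finite I x ax
    ...   | k , lx rewrite lx = minL-fin k (low s (hd a))

  active-after-finish : ∀ s v x → visited s x ≡ true × upd (done s) v true x ≡ false → x ≢ v × Active s x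
  active-after-finish s v x (vx , dx) with upd-still-false (done s) v x dx
  ... | x≢v , dx' = x≢v , vx , dx'

  postvisit-invariant : ∀ {s v} (F' : List (Fin n)) (L' : Fin n → Low) (c' : Maybe (Fin n)) →
    Invariant s → current s ≡ just v → AllExitTraversed G s v → c' ≡ Maybe.map tl (parent s v) →
    (∀ x → x ∈ F' → x ∈ F s ⊎ x ≡ v) → (∀ x → Active s x → x ≢ v → ∃ λ k → L' x ≡ fin k) →
    Invariant (record s { done = upd (done s) v true ; F = F' ; low = L' ; current = c' })
  postvisit-invariant {s} {v} F' L' c' I c≡ ae c'≡ F'⊆ finite = record
    { done⇒visited = done⇒visited' ; pre≤counter = pre≤counter I ; pre-injective = pre-injective I
    ; traversed⇒visited = traversed⇒visited I ; done⇒traversed = done⇒traversed'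
    ; idle⇒inactive = proj₁ (continue below complete sound isTreePath)
    ; activePath = proj₂ (continue below complete sound isTreePath)
    ; F⇒done = F⇒done'
    ; active⇒finite = λ x ax → let (x≢v , ax') = active-after-finish s v x ax in finite x ax' x≢v }
    where
    s' : State G
    s' = record s { done = upd (done s) v true ; F = F' ; low = L' ; current = c' }
    open ActivePath (activePath I c≡)
    done⇒visited' : ∀ x → upd (done s) v true x ≡ true → visited s x ≡ true
    done⇒visited' x d with x ≟ v
    ... | yes refl = proj₁ (current-active I c≡)
    ... | no _ = done⇒visited I x d
    done⇒traversed' : ∀ x → upd (done s) v true x ≡ true → AllExitTraversed G s x
    done⇒traversed' x d with x ≟ v
    ... | yes refl = ae
    ... | no _ = done⇒traversed I x d
    F⇒done' : ∀ x → x ∈ F' → upd (done s) v true x ≡ true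
    F⇒done' x x∈ with F'⊆ x x∈
    ... | inj₁ old = upd-keeps-true (done s) v x (F⇒done I x old)
    ... | inj₂ refl = upd-≡ (done s) x true
    -- the tree path below v continues at the tail of the tree arc entering v
    continue : ∀ S → (∀ x → Active s x → x ∈ v ∷ S) → (∀ x → x ∈ v ∷ S → Active s x) →
      TreePath s (v ∷ S) →
      (c' ≡ nothing → ∀ x → ¬ Active s' x) × (∀ {c} → c' ≡ just c → ActivePath s' c)
    continue [] complete _ (rootPath p) = idle , λ c'≡c → ⊥-elim (nothing≢just (trans (sym idle') c'≡c))
      where
      idle' : c' ≡ nothing
      idle' = trans c'≡ (cong (Maybe.map tl) p)
      idle : c' ≡ nothing → ∀ x → ¬ Active s' x
      idle _ x ax with active-after-finish s v x ax
      ... | x≢v , ax' with complete x ax'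
      ...   | Any.here x≡v = x≢v x≡v
    continue (y ∷ S) complete sound path@(childPath a p ta _ y<v tp) =
      (λ c'≡nothing → ⊥-elim (nothing≢just (trans (sym c'≡nothing) c'≡y))) , parentPath
      where
      c'≡y : c' ≡ just y
      c'≡y = trans c'≡ (trans (cong (Maybe.map tl) p) (cong just ta))
      stays : ∀ x → x ∈ y ∷ S → Active s' x
      stays x x∈ = proj₁ (sound x (Any.there x∈)) ,
        trans (upd-≢ (done s) v true x (λ { refl → <-irrefl refl (TreePath-below path x∈) }))
              (proj₂ (sound x (Any.there x∈)))
      complete' : ∀ x → Active s' x → x ∈ y ∷ S
      complete' x ax with active-after-finish s v x ax
      ... | x≢v , ax' with complete x ax'
      ...   | Any.here x≡v = ⊥-elim (x≢v x≡v)
      ...   | Any.there x∈ = x∈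
      parentPath : ∀ {c} → c' ≡ just c → ActivePath s' c
      parentPath c'≡c with just-injective (trans (sym c'≡c) c'≡y)
      ... | refl = record { below = S ; complete = complete' ; sound = stays
                          ; isTreePath = TreePath-stable (λ _ _ → refl , refl) tp }

  popLoop-rest⊆ : ∀ L b xs {u} → u ∈ proj₂ (popLoop G L b xs) → u ∈ xs
  popLoop-rest⊆ L b (x ∷ xs) u∈ with geqL (L x) b
  ... | true = Any.there (popLoop-rest⊆ (upd L x ∞) b xs u∈)
  ... | false = u∈

  popLoop-untouched : ∀ L b xs u → ¬ (u ∈ xs) → proj₁ (popLoop G L b xs) u ≡ L u
  popLoop-untouched L b [] u _ = refl
  popLoop-untouched L b (x ∷ xs) u u∉ with geqL (L x) b
  ... | false = refl
  ... | true = trans (popLoop-untouched (upd L x ∞) b xs u (λ u∈ → u∉ (Any.there u∈)))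
                     (upd-≢ L x ∞ u (λ u≡x → u∉ (Any.here u≡x)))

  popLoop-∞ : ∀ L b xs u → L u ≡ ∞ → proj₁ (popLoop G L b xs) u ≡ ∞
  popLoop-∞ L b [] u e = e
  popLoop-∞ L b (x ∷ xs) u e with geqL (L x) b
  ... | false = e
  ... | true = popLoop-∞ (upd L x ∞) b xs u upd-∞
    where upd-∞ : upd L x ∞ u ≡ ∞
          upd-∞ with u ≟ x
          ... | yes _ = refl
          ... | no _ = e

  PrefixClosed-popLoop : ∀ q L b xs → PrefixClosed q xs → PrefixClosed q (proj₂ (popLoop G L b xs))
  PrefixClosed-popLoop q L b [] pc = tt
  PrefixClosed-popLoop q L b (x ∷ xs) pc with geqL (L x) b
  ... | true = PrefixClosed-popLoop q (upd L x ∞) b xs (proj₂ pc)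
  ... | false = pc

  -- When the test low ≥ b coincides on the stack with a prefix-closed predicate p,
  -- the popping loop pops exactly the elements satisfying p.
  module _ (p : Fin n → Bool) (b : Low) where
    Agrees : (Fin n → Low) → List (Fin n) → Set
    Agrees L xs = ∀ x → x ∈ xs → geqL (L x) b ≡ p x

    Agrees-pop : ∀ {L x xs} → p x ≡ true → Agrees L (x ∷ xs) → Agrees (upd L x ∞) xs
    Agrees-pop {x = x} px ag y y∈ with y ≟ x
    ... | yes refl = sym px
    ... | no _ = ag y (Any.there y∈)

    prefix-false : ∀ {x xs u} → p x ≡ false → PrefixClosed p (x ∷ xs) → u ∈ x ∷ xs → p u ≡ false
    prefix-false px _ (Any.here refl) = px
    prefix-false px (stop , _) (Any.there u∈) = All.lookup (stop px) u∈

    popLoop-low : ∀ L xs → Agrees L xs → ∀ u → proj₁ (popLoop G L b xs) u ≡ L u ⊎ (u ∈ xs × p u ≡ true)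
    popLoop-low L [] ag u = inj₁ refl
    popLoop-low L (x ∷ xs) ag u with geqL (L x) b | ag x (Any.here refl)
    ... | false | _ = inj₁ refl
    ... | true | px with popLoop-low (upd L x ∞) xs (Agrees-pop (sym px) ag) u
    ...   | inj₂ (u∈ , pu) = inj₂ (Any.there u∈ , pu)
    ...   | inj₁ e with u ≟ x
    ...     | yes refl = inj₂ (Any.here refl , sym px)
    ...     | no _ = inj₁ e

    popLoop-pops : ∀ L xs → Agrees L xs → PrefixClosed p xs → ∀ u → u ∈ xs → p u ≡ true →
      proj₁ (popLoop G L b xs) u ≡ ∞
    popLoop-pops L (x ∷ xs) ag pc u u∈ pu with geqL (L x) b | ag x (Any.here refl)
    ... | false | px = ⊥-elim (true≢false (trans (sym pu) (prefix-false (sym px) pc u∈)))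
    ... | true | px with u∈
    ...   | Any.here refl = popLoop-∞ (upd L u ∞) b xs u (upd-≡ L u ∞)
    ...   | Any.there u∈xs = popLoop-pops (upd L x ∞) xs (Agrees-pop (sym px) ag) (proj₂ pc) u u∈xs pu

    popLoop-rest : ∀ L xs → Agrees L xs → PrefixClosed p xs →
      ∀ u → u ∈ proj₂ (popLoop G L b xs) → p u ≡ false
    popLoop-rest L (x ∷ xs) ag pc u u∈ with geqL (L x) b | ag x (Any.here refl)
    ... | true | px = popLoop-rest (upd L x ∞) xs (Agrees-pop (sym px) ag) (proj₂ pc) u u∈
    ... | false | px = prefix-false (sym px) pc u∈

    popLoop-keeps : ∀ L xs → Agrees L xs → ∀ u → u ∈ xs → p u ≡ false → u ∈ proj₂ (popLoop G L b xs)
    popLoop-keeps L (x ∷ xs) ag u u∈ pu with geqL (L x) b | ag x (Any.here refl)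
    ... | false | _ = u∈
    ... | true | px with u∈
    ...   | Any.here refl = ⊥-elim (true≢false (trans px pu))
    ...   | Any.there u∈xs = popLoop-keeps (upd L x ∞) xs (Agrees-pop (sym px) ag) u u∈xs pu

  report-active-low : ∀ s v x → Invariant s → Active s x → x ≢ v → low (report s v) x ≡ low s x
  report-active-low s v x I ax x≢v =
    trans (upd-≢ (proj₁ (popLoop G (low s) (low s v) (F s))) v ∞ x x≢v)
          (popLoop-untouched (low s) (low s v) (F s) x (active∉F I ax))

  returnAlong-finite : ∀ s v a t → Invariant s → (∀ x → Active s x → x ≢ v → low t x ≡ low s x) →
    ∀ x → Active s x → x ≢ v → ∃ λ k → low (returnAlong t v a) x ≡ fin k
  returnAlong-finite s v a t I same x ax x≢v with x ≟ tl a
  ... | no _ = subst (λ l → ∃ λ k → l ≡ fin k) (sym (same x ax x≢v)) (active⇒finite I x ax)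
  ... | yes refl with active⇒finite I x ax
  ...   | k , lx rewrite same x ax x≢v | lx = minL-fin k (low t v)

  push-F⊆ : ∀ s v x → x ∈ F (push s v) → x ∈ F s ⊎ x ≡ v
  push-F⊆ s v x (Any.here x≡v) = inj₂ x≡v
  push-F⊆ s v x (Any.there x∈) = inj₁ x∈

  invariant-step : ∀ {s l s'} → Invariant s → StepView s l s' → Invariant s'
  invariant-step I (rootStep v idle nv) = root-invariant _ v I idle nv
  invariant-step I (treeStep a c≡ _ nv) = tree-invariant _ a I c≡ nv
  invariant-step I (nontreeStep a c≡ _ vh) = nontree-invariant _ a I c≡ vh
  invariant-step {s} I (rootReport v c≡ ae p _) =
    postvisit-invariant _ _ nothing I c≡ ae (sym (cong (Maybe.map tl) p)) 
      (λ x x∈ → inj₁ (popLoop-rest⊆ (low s) (low s v) (F s) x∈))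
      (λ x ax x≢v → subst (λ l → ∃ λ k → l ≡ fin k) (sym (report-active-low s v x I ax x≢v))
                          (active⇒finite I x ax))
  invariant-step {s} I (rootPush v c≡ ae p _) =
    postvisit-invariant _ _ nothing I c≡ ae (sym (cong (Maybe.map tl) p)) (push-F⊆ s v)
      (λ x ax _ → active⇒finite I x ax)
  invariant-step {s} I (childReport v a c≡ ae p _) =
    postvisit-invariant _ _ (just (tl a)) I c≡ ae (sym (cong (Maybe.map tl) p))
      (λ x x∈ → inj₁ (popLoop-rest⊆ (low s) (low s v) (F s) x∈))
      (returnAlong-finite s v a (report s v) I (λ x ax x≢v → report-active-low s v x I ax x≢v))
  invariant-step {s} I (childPush v a c≡ ae p _) =
    postvisit-invariant _ _ (just (tl a)) I c≡ ae (sym (cong (Maybe.map tl) p)) (push-F⊆ s v)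
      (returnAlong-finite s v a (push s v) I (λ _ _ _ → refl))

  postvisit-label : ∀ {s l s' v} → StepView s l s' → Postvisits G l v →
    current s ≡ just v × AllExitTraversed G s v
  postvisit-label (rootReport _ c≡ ae _ _) refl = c≡ , ae
  postvisit-label (rootPush _ c≡ ae _ _) refl = c≡ , ae
  postvisit-label (childReport _ _ c≡ ae _ _) refl = c≡ , ae
  postvisit-label (childPush _ _ c≡ ae _ _) refl = c≡ , ae

  step-visited-mono : ∀ {s l s'} → StepView s l s' → ∀ x → visited s x ≡ true → visited s' x ≡ true
  step-visited-mono {s} (rootStep v _ _) x e = upd-keeps-true (visited s) v x e
  step-visited-mono {s} (treeStep a _ _ _) x e = upd-keeps-true (visited s) (hd a) x e
  step-visited-mono (nontreeStep _ _ _ _) x e = e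
  step-visited-mono (rootReport _ _ _ _ _) x e = e
  step-visited-mono (rootPush _ _ _ _ _) x e = e
  step-visited-mono (childReport _ _ _ _ _ _) x e = e
  step-visited-mono (childPush _ _ _ _ _ _) x e = e

  step-done-mono : ∀ {s l s'} → StepView s l s' → ∀ x → done s x ≡ true → done s' x ≡ true
  step-done-mono (rootStep _ _ _) x e = e
  step-done-mono (treeStep _ _ _ _) x e = e
  step-done-mono (nontreeStep _ _ _ _) x e = e
  step-done-mono {s} (rootReport v _ _ _ _) x e = upd-keeps-true (done s) v x e
  step-done-mono {s} (rootPush v _ _ _ _) x e = upd-keeps-true (done s) v x e
  step-done-mono {s} (childReport v _ _ _ _ _) x e = upd-keeps-true (done s) v x e
  step-done-mono {s} (childPush v _ _ _ _ _) x e = upd-keeps-true (done s) v x e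

  step-counter-mono : ∀ {s l s'} → StepView s l s' → counter s ≤ counter s'
  step-counter-mono (rootStep _ _ _) = n≤1+n _
  step-counter-mono (treeStep _ _ _ _) = n≤1+n _
  step-counter-mono (nontreeStep _ _ _ _) = ≤-refl
  step-counter-mono (rootReport _ _ _ _ _) = ≤-refl
  step-counter-mono (rootPush _ _ _ _ _) = ≤-refl
  step-counter-mono (childReport _ _ _ _ _ _) = ≤-refl
  step-counter-mono (childPush _ _ _ _ _ _) = ≤-refl

  step-pre-stable : ∀ {s l s'} → StepView s l s' → ∀ x → visited s x ≡ true →
    pre s' x ≡ pre s x × parent s' x ≡ parent s x
  step-pre-stable {s} (rootStep v _ nv) x vx = upd-≢ (pre s) v _ x x≢v , upd-≢ (parent s) v _ x x≢v
    where x≢v : x ≢ v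
          x≢v refl = true≢false (trans (sym vx) nv)
  step-pre-stable {s} (treeStep a _ _ nv) x vx = upd-≢ (pre s) (hd a) _ x x≢hd , upd-≢ (parent s) (hd a) _ x x≢hd
    where x≢hd : x ≢ hd a
          x≢hd refl = true≢false (trans (sym vx) nv)
  step-pre-stable (nontreeStep _ _ _ _) x _ = refl , refl
  step-pre-stable (rootReport _ _ _ _ _) x _ = refl , refl
  step-pre-stable (rootPush _ _ _ _ _) x _ = refl , refl
  step-pre-stable (childReport _ _ _ _ _ _) x _ = refl , refl
  step-pre-stable (childPush _ _ _ _ _ _) x _ = refl , refl

  step-previsit-pre : ∀ {s l s'} → StepView s l s' → ∀ x → visited s x ≡ false → visited s' x ≡ true →
    pre s' x ≡ suc (counter s)
  step-previsit-pre (rootStep v _ _) x nx vx with x ≟ v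
  ... | yes _ = refl
  ... | no _ = ⊥-elim (true≢false (trans (sym vx) nx))
  step-previsit-pre (treeStep a _ _ _) x nx vx with x ≟ hd a
  ... | yes _ = refl
  ... | no _ = ⊥-elim (true≢false (trans (sym vx) nx))
  step-previsit-pre (nontreeStep _ _ _ _) x nx vx = ⊥-elim (true≢false (trans (sym vx) nx))
  step-previsit-pre (rootReport _ _ _ _ _) x nx vx = ⊥-elim (true≢false (trans (sym vx) nx))
  step-previsit-pre (rootPush _ _ _ _ _) x nx vx = ⊥-elim (true≢false (trans (sym vx) nx))
  step-previsit-pre (childReport _ _ _ _ _ _) x nx vx = ⊥-elim (true≢false (trans (sym vx) nx))
  step-previsit-pre (childPush _ _ _ _ _ _) x nx vx = ⊥-elim (true≢false (trans (sym vx) nx))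

  PostvisitStep : Label G → State G → Fin n → Set
  PostvisitStep l s x = Postvisits G l x × current s ≡ just x × (∀ a → parent s x ≡ just a → Retreats G l a)

  root-postvisit : ∀ {s} v → current s ≡ just v → parent s v ≡ nothing →
    ∀ x → done s x ≡ false → upd (done s) v true x ≡ true → PostvisitStep (postRoot v) s x
  root-postvisit v c≡ p x nd d with x ≟ v
  ... | yes refl = refl , c≡ , λ a q → ⊥-elim (nothing≢just (trans (sym p) q))
  ... | no _ = ⊥-elim (true≢false (trans (sym d) nd))

  child-postvisit : ∀ {s} v a → current s ≡ just v → parent s v ≡ just a →
    ∀ x → done s x ≡ false → upd (done s) v true x ≡ true → PostvisitStep (postChild v a) s x
  child-postvisit v a c≡ p x nd d with x ≟ v
  ... | yes refl = refl , c≡ , λ b q → just-injective (trans (sym p) q)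
  ... | no _ = ⊥-elim (true≢false (trans (sym d) nd))

  step-postvisit : ∀ {s l s'} → StepView s l s' → ∀ x → done s x ≡ false → done s' x ≡ true →
    PostvisitStep l s x
  step-postvisit (rootStep _ _ _) x nd d = ⊥-elim (true≢false (trans (sym d) nd))
  step-postvisit (treeStep _ _ _ _) x nd d = ⊥-elim (true≢false (trans (sym d) nd))
  step-postvisit (nontreeStep _ _ _ _) x nd d = ⊥-elim (true≢false (trans (sym d) nd))
  step-postvisit {s} (rootReport v c≡ _ p _) x nd d = root-postvisit {s} v c≡ p x nd d
  step-postvisit {s} (rootPush v c≡ _ p _) x nd d = root-postvisit {s} v c≡ p x nd d
  step-postvisit {s} (childReport v a c≡ _ p _) x nd d = child-postvisit {s} v a c≡ p x nd d
  step-postvisit {s} (childPush v a c≡ _ p _) x nd d = child-postvisit {s} v a c≡ p x nd d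

  step-traversal : ∀ {s l s'} → StepView s l s' → ∀ b → traversed s b ≡ false → traversed s' b ≡ true →
    current s ≡ just (tl b) × (visited s (hd b) ≡ false ⊎ l ≡ nontree b)
  step-traversal (rootStep _ _ _) b nt t = ⊥-elim (true≢false (trans (sym t) nt))
  step-traversal (treeStep a c≡ _ nh) b nt t with b ≟ a
  ... | yes refl = c≡ , inj₁ nh
  ... | no _ = ⊥-elim (true≢false (trans (sym t) nt))
  step-traversal (nontreeStep a c≡ _ _) b nt t with b ≟ a
  ... | yes refl = c≡ , inj₂ refl
  ... | no _ = ⊥-elim (true≢false (trans (sym t) nt))
  step-traversal (rootReport _ _ _ _ _) b nt t = ⊥-elim (true≢false (trans (sym t) nt))
  step-traversal (rootPush _ _ _ _ _) b nt t = ⊥-elim (true≢false (trans (sym t) nt))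
  step-traversal (childReport _ _ _ _ _ _) b nt t = ⊥-elim (true≢false (trans (sym t) nt))
  step-traversal (childPush _ _ _ _ _ _) b nt t = ⊥-elim (true≢false (trans (sym t) nt))

  module OnRun (R : Run G) where
    at : ℕ → State G
    at = st R

    fP : Fin n → ℕ
    fP = finalPre G R

    view : ∀ i → i < len R → StepView (at i) (lbl R i) (at (suc i))
    view i i<L = step⇒view (steps R i i<L)

    invariant : ∀ i → i ≤ len R → Invariant (at i)
    invariant zero _ = subst Invariant (sym (start R)) invariant-initial
    invariant (suc i) i<L = invariant-step (invariant i (<⇒≤ i<L)) (view i i<L)

    visited-mono : ∀ {i j} x → i ≤ j → j ≤ len R → visited (at i) x ≡ true → visited (at j) x ≡ true
    visited-mono {j = j} x i≤j j≤L vx = interval-induction (λ k → visited (at k) x ≡ true) vx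
      (λ k _ k<L → step-visited-mono (view k k<L) x) j i≤j j≤L

    done-mono : ∀ {i j} x → i ≤ j → j ≤ len R → done (at i) x ≡ true → done (at j) x ≡ true
    done-mono {j = j} x i≤j j≤L dx = interval-induction (λ k → done (at k) x ≡ true) dx
      (λ k _ k<L → step-done-mono (view k k<L) x) j i≤j j≤L

    counter-mono : ∀ {i j} → i ≤ j → j ≤ len R → counter (at i) ≤ counter (at j)
    counter-mono {i} {j} i≤j j≤L = interval-induction (λ k → counter (at i) ≤ counter (at k)) ≤-refl
      (λ k _ k<L c≤ → ≤-trans c≤ (step-counter-mono (view k k<L))) j i≤j j≤L

    pre-stable : ∀ {i j} x → i ≤ j → j ≤ len R → visited (at i) x ≡ true →
      pre (at j) x ≡ pre (at i) x × parent (at j) x ≡ parent (at i) x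
    pre-stable {i} {j} x i≤j j≤L vx =
      interval-induction (λ k → pre (at k) x ≡ pre (at i) x × parent (at k) x ≡ parent (at i) x) (refl , refl)
        (λ k i≤k k<L (pre≡ , parent≡) →
           let (pre≡' , parent≡') = step-pre-stable (view k k<L) x (visited-mono x i≤k (<⇒≤ k<L) vx)
           in trans pre≡' pre≡ , trans parent≡' parent≡)
        j i≤j j≤L

    PreIsFinal : State G → Set
    PreIsFinal s = ∀ x → visited s x ≡ true → fP x ≡ pre s x

    preIsFinal : ∀ i → i ≤ len R → PreIsFinal (at i)
    preIsFinal i i≤L x vx = proj₁ (pre-stable x i≤L ≤-refl vx)

    all-visited : ∀ x → visited (at (len R)) x ≡ true
    all-visited = proj₁ (proj₂ (finish R))

    all-done : ∀ x → done (at (len R)) x ≡ true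
    all-done x with done (at (len R)) x in dx
    ... | true = refl
    ... | false = ⊥-elim (idle⇒inactive (invariant (len R) ≤-refl) (proj₁ (finish R)) x (all-visited x , dx))

    VisitedDownClosed : State G → Set
    VisitedDownClosed s = ∀ x y → visited s x ≡ true → fP y ≤ fP x → visited s y ≡ true

    visited-downClosed : ∀ i → i ≤ len R → VisitedDownClosed (at i)
    visited-downClosed i i≤L x y vx y≤x with visited (at i) y in vy
    ... | true = refl
    ... | false with rising-edge (λ k → visited (at k) y) i≤L vy (all-visited y)
    ...   | k , i≤k , k<L , nk , vk = ⊥-elim (<⇒≱ x<y y≤x)
      where
      open ≤-Reasoning
      x<y : fP x < fP y
      x<y = begin-strict
        fP x                 ≡⟨ preIsFinal i i≤L x vx ⟩
        pre (at i) x         ≤⟨ pre≤counter (invariant i i≤L) x vx ⟩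
        counter (at i)       ≤⟨ counter-mono i≤k (<⇒≤ k<L) ⟩
        counter (at k)       <⟨ n<1+n _ ⟩
        suc (counter (at k)) ≡⟨ sym (step-previsit-pre (view k k<L) y nk vk) ⟩
        pre (at (suc k)) y   ≡⟨ sym (preIsFinal (suc k) k<L y vk) ⟩
        fP y                 ∎

    PostvisitAt : Fin n → ℕ → Set
    PostvisitAt x T = T < len R × done (at T) x ≡ false × done (at (suc T)) x ≡ true

    postvisit-after : ∀ {i} x → i ≤ len R → done (at i) x ≡ false → ∃ λ T → i ≤ T × PostvisitAt x T
    postvisit-after x i≤L nd with rising-edge (λ k → done (at k) x) i≤L nd (all-done x)
    ... | T , i≤T , T<L , ndT , dT = T , i≤T , T<L , ndT , dT

    postvisit-step : ∀ {x T} → PostvisitAt x T → PostvisitStep (lbl R T) (at T) x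
    postvisit-step (T<L , nd , d) = step-postvisit (view _ T<L) _ nd d

    undone-before : ∀ {i j} x → i ≤ j → j ≤ len R → done (at j) x ≡ false → done (at i) x ≡ false
    undone-before {i} x i≤j j≤L nd with done (at i) x in d
    ... | true = ⊥-elim (true≢false (trans (sym (done-mono x i≤j j≤L d)) nd))
    ... | false = refl

    undone-before-done : ∀ {i j} x → i ≤ len R → done (at i) x ≡ false → done (at j) x ≡ true → i < j
    undone-before-done {i} {j} x i≤L nd d with i <? j
    ... | yes i<j = i<j
    ... | no i≮j = ⊥-elim (true≢false (trans (sym (done-mono x (≮⇒≥ i≮j) i≤L d)) nd))

    backward-arc-retreat : ∀ {T} b → T ≤ len R → traversed (at T) b ≡ true → fP (hd b) < fP (tl b) →
      ∃ λ t → t < T × current (at t) ≡ just (tl b) × lbl R t ≡ nontree b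
    backward-arc-retreat {T} b T≤L tb hd<tl
      with rising-edge (λ k → traversed (at k) b) z≤n (cong (λ s → traversed s b) (start R)) tb
    ... | t , _ , t<T , nt , tt′ with step-traversal (view t (<-≤-trans t<T T≤L)) b nt tt′
    ...   | c≡ , inj₂ nontree≡ = t , t<T , c≡ , nontree≡
    ...   | c≡ , inj₁ nh = ⊥-elim (<-asym hd<tl tl<hd)
      where
      open ≤-Reasoning
      t<L : t < len R
      t<L = <-≤-trans t<T T≤L
      vtl : visited (at t) (tl b) ≡ true
      vtl = proj₁ (current-active (invariant t (<⇒≤ t<L)) c≡)
      vhd : visited (at (suc t)) (hd b) ≡ true
      vhd = traversed⇒visited (invariant (suc t) t<L) b tt′
      tl<hd : fP (tl b) < fP (hd b)
      tl<hd = begin-strict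
        fP (tl b)             ≡⟨ preIsFinal t (<⇒≤ t<L) (tl b) vtl ⟩
        pre (at t) (tl b)     ≤⟨ pre≤counter (invariant t (<⇒≤ t<L)) (tl b) vtl ⟩
        counter (at t)        <⟨ n<1+n _ ⟩
        suc (counter (at t))  ≡⟨ sym (step-previsit-pre (view t t<L) (hd b) nh vhd) ⟩
        pre (at (suc t)) (hd b) ≡⟨ sym (preIsFinal (suc t) t<L (hd b) vhd) ⟩
        fP (hd b)             ∎

    -- the retreat times decrease along the path and all precede T
    record RetreatingPath (v c y : Fin n) (T : ℕ) : Set where
      field
        arcs        : List (Fin m)
        times       : List ℕ
        path        : Path G c y arcs
        inComponent : All (Mutual G v) (map hd arcs)
        retreats    : Pointwise (RetreatsAt G R) arcs times
        before      : Linked _>_ (T ∷ times)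

    RetreatingFromPostvisit : Fin n → Fin n → Fin n → Set
    RetreatingFromPostvisit v c y = ∀ T → PostvisitAt c T → RetreatingPath v c y T

    retreat-nontree-arc : ∀ {t v b} → t < len R → current (at t) ≡ just (tl b) → lbl R t ≡ nontree b →
      Mutual G v (hd b) → RetreatingFromPostvisit v (tl b) (hd b)
    retreat-nontree-arc {t} {v} {b} t<L ct nontree≡ v-hd Tx post = record
      { arcs = b ∷ [] ; times = t ∷ [] ; path = refl ∷ [] ; inComponent = v-hd ∷ []
      ; retreats = (t<L , subst (λ l → Retreats G l b) (sym nontree≡) refl) ∷ []
      ; before = t<Tx ∷ [-] }
      where
      t≤Tx : t ≤ Tx
      t≤Tx = s≤s⁻¹ (undone-before-done (tl b) (<⇒≤ t<L)
                      (proj₂ (current-active (invariant t (<⇒≤ t<L)) ct)) (proj₂ (proj₂ post)))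
      t<Tx : t < Tx
      t<Tx with m≤n⇒m<n∨m≡n t≤Tx
      ... | inj₁ t<Tx = t<Tx
      ... | inj₂ refl = ⊥-elim (subst (λ l → Postvisits G l (tl b)) nontree≡ (proj₁ (postvisit-step post)))

    -- the tree arc a from c' to c is retreated at the postvisit of c, before c' is postvisited
    retreat-tree-arc : ∀ {t v c c' y a} → t < len R → parent (at t) c ≡ just a → tl a ≡ c' → hd a ≡ c →
      Active (at t) c → Active (at t) c' → pre (at t) c' < pre (at t) c → Mutual G v c →
      RetreatingFromPostvisit v c y → RetreatingFromPostvisit v c' y
    retreat-tree-arc {t} {v} {c} {c'} {y} {a} t<L pa ta ha ac ac' c'<c vc P Tc' post'@(Tc'<L , _ , c'-done)
      with postvisit-after c (<⇒≤ t<L) (proj₂ ac)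
    ... | Tc , t≤Tc , postc@(Tc<L , c-undone , _) = record
      { arcs = a ∷ arcs ; times = Tc ∷ times
      ; path = ta ∷ subst (λ z → Path G z y arcs) (sym ha) path
      ; inComponent = subst (Mutual G v) (sym ha) vc ∷ inComponent
      ; retreats = (Tc<L , retreats-a) ∷ retreats
      ; before = undone-before-done c (<⇒≤ Tc<L) c-undone c-done ∷ before }
      where
      open RetreatingPath (P Tc postc)
      retreats-a : Retreats G (lbl R Tc) a
      retreats-a = proj₂ (proj₂ (postvisit-step postc)) a
                     (trans (proj₂ (pre-stable c t≤Tc (<⇒≤ Tc<L) (proj₁ ac))) pa)
      t≤Tc' : t ≤ Tc'
      t≤Tc' = s≤s⁻¹ (undone-before-done c' (<⇒≤ t<L) (proj₂ ac') c'-done)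
      -- at the postvisit of c', an unfinished c would lie below c' on the tree path
      c-done : done (at Tc') c ≡ true
      c-done with done (at Tc') c in dc
      ... | true = refl
      ... | false = ⊥-elim (<⇒≱ c'<c (subst₂ _≤_ (proj₁ (pre-stable c t≤Tc' (<⇒≤ Tc'<L) (proj₁ ac)))
                                               (proj₁ (pre-stable c' t≤Tc' (<⇒≤ Tc'<L) (proj₁ ac')))
                                               (active-pre≤current (invariant Tc' (<⇒≤ Tc'<L))
                                                  (proj₁ (proj₂ (postvisit-step post')))
                                                  (visited-mono c t≤Tc' (<⇒≤ Tc'<L) (proj₁ ac) , dc))))

    retreat-down-path : ∀ {t v y c} → t < len R → ∀ S → TreePath (at t) (c ∷ S) →
      (∀ z → z ∈ c ∷ S → Active (at t) z) → v ∈ c ∷ S → Reach G c v →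
      RetreatingFromPostvisit v c y → RetreatingFromPostvisit v v y
    retreat-down-path t<L S tp act (Any.here refl) cv P = P
    retreat-down-path t<L [] (rootPath _) act (Any.there ()) cv P
    retreat-down-path {v = v} {c = c} t<L (c' ∷ S) tp@(childPath a pa ta ha c'<c tp') act (Any.there v∈) cv P =
      retreat-down-path t<L S tp' (λ z z∈ → act z (Any.there z∈)) v∈ c'v
        (retreat-tree-arc t<L pa ta ha (act c (Any.here refl)) (act c' (Any.there (Any.here refl))) c'<c vc P)
      where
      c'v : Reach G c' v
      c'v = there a ta (subst (λ z → Reach G z v) (sym ha) cv)
      vc : Mutual G v c
      vc = TreePath-reach tp (Any.there v∈) , cv

    retreating-from-exit : ∀ {T v b} → T < len R → current (at T) ≡ just v → traversed (at T) b ≡ true →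
      fP v ≤ fP (tl b) → fP (hd b) < fP v → Mutual G v (hd b) → RetReach G R v (hd b)
    retreating-from-exit {T} {v} {b} T<L c≡ tb v≤tl hd<v v-hd
      with backward-arc-retreat b (<⇒≤ T<L) tb (<-≤-trans hd<v v≤tl)
    ... | t , t<T , ct , nontree≡ = arcs , path , inComponent , times , retreats , Linked.tail before
      where
      t<L : t < len R
      t<L = <-trans t<T T<L
      It : Invariant (at t)
      It = invariant t (<⇒≤ t<L)
      v-undone : done (at T) v ≡ false
      v-undone = proj₂ (current-active (invariant T (<⇒≤ T<L)) c≡)
      v-active : Active (at t) v
      v-active = visited-downClosed t (<⇒≤ t<L) (tl b) v (proj₁ (current-active It ct)) v≤tl ,
                 undone-before v (<⇒≤ t<T) (<⇒≤ T<L) v-undone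
      postv : ∃ λ Tv → T ≤ Tv × PostvisitAt v Tv
      postv = postvisit-after v (<⇒≤ T<L) v-undone
      open ActivePath (activePath It ct)
      open RetreatingPath (retreat-down-path t<L below isTreePath sound (complete v v-active)
                             (there b refl (proj₂ v-hd)) (retreat-nontree-arc t<L ct nontree≡ v-hd)
                             (proj₁ postv) (proj₂ (proj₂ postv)))

    -- the tree path from v down to the first arc leaving the vertices above v, followed by that arc
    earlier-in-component : ∀ {T v w} → T < len R → current (at T) ≡ just v → AllExitTraversed G (at T) v →
      Mutual G v w → fP w < fP v → Σ (Fin n) λ z → RetReach G R v z × fP z < fP v
    earlier-in-component {T} {v} {w} T<L c≡ ae vw w<v =
      from-exit (exit-below I c≡ ae (proj₁ vact , ≤-refl) ¬above-w (proj₁ vw))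
      where
      I : Invariant (at T)
      I = invariant T (<⇒≤ T<L)
      vact : Active (at T) v
      vact = current-active I c≡
      fP≡ : PreIsFinal (at T)
      fP≡ = preIsFinal T (<⇒≤ T<L)
      ¬above-w : ¬ Above I v w
      ¬above-w (vw' , v≤w) = <⇒≱ w<v (subst₂ _≤_ (sym (fP≡ v (proj₁ vact))) (sym (fP≡ w vw')) v≤w)
      from-exit : ExitArc I v v w → Σ (Fin n) λ z → RetReach G R v z × fP z < fP v
      from-exit (b , (vtl , v≤tl) , tb , hd<v , v⇝tl , hd⇝w) =
        hd b , retreating-from-exit T<L c≡ tb fP-v≤tl fP-hd<v v-hd , fP-hd<v
        where
        fP-v≤tl : fP v ≤ fP (tl b)
        fP-v≤tl = subst₂ _≤_ (sym (fP≡ v (proj₁ vact))) (sym (fP≡ (tl b) vtl)) v≤tl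
        fP-hd<v : fP (hd b) < fP v
        fP-hd<v = subst₂ _<_ (sym (fP≡ (hd b) (traversed⇒visited I b tb))) (sym (fP≡ v (proj₁ vact))) hd<v
        v-hd : Mutual G v (hd b)
        v-hd = Reach-trans v⇝tl (there b refl here) , Reach-trans hd⇝w (proj₂ vw)

    low≡pre⇒leader : ∀ {T v} → T < len R → current (at T) ≡ just v → AllExitTraversed G (at T) v →
      CorrectLow G R v (low (at T) v) → low (at T) v ≡ fin (fP v) → ∀ w → Mutual G v w → fP v ≤ fP w
    low≡pre⇒leader {T} {v} T<L c≡ ae (k , lk , _ , minimal) low≡ w vw =
      ≮⇒≥ λ w<v → no-earlier (earlier-in-component T<L c≡ ae vw w<v)
      where
      no-earlier : ¬ (Σ (Fin n) λ z → RetReach G R v z × fP z < fP v)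
      no-earlier (z , vz , z<v) = <⇒≱ z<v (subst (_≤ fP z) (fin-injective (trans (sym lk) low≡)) (minimal z vz))

    fP-injective : ∀ {s x y} → Invariant s → PreIsFinal s → visited s x ≡ true → visited s y ≡ true →
      fP x ≡ fP y → x ≡ y
    fP-injective {x = x} {y} I fP≡ vx vy e = pre-injective I x y vx vy (trans (sym (fP≡ x vx)) (trans e (fP≡ y vy)))

    active-fP<current : ∀ {s v u} → Invariant s → PreIsFinal s → current s ≡ just v →
      Active s u → u ≢ v → fP u < fP v
    active-fP<current {s} {v} {u} I fP≡ c≡ au u≢v =
      ≤∧≢⇒< (subst₂ _≤_ (sym (fP≡ u (proj₁ au))) (sym (fP≡ v (proj₁ vact))) (active-pre≤current I c≡ au))
            (λ e → u≢v (fP-injective I fP≡ (proj₁ au) (proj₁ vact) e))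
      where
      vact : Active s v
      vact = current-active I c≡

    after : Fin n → Fin n → Bool
    after u x = fP u <ᵇ fP x

    record ComponentInvariant (s : State G) : Set where
      field
        ∞⇒component-done : ∀ x → visited s x ≡ true → low s x ≡ ∞ → ∀ y → Mutual G x y → done s y ≡ true
        leader-done⇒∞    : ∀ v ℓ → visited s v ≡ true → IsLeader G R ℓ v → done s ℓ ≡ true → low s v ≡ ∞
        F-low            : ∀ x → x ∈ F s → Σ (Fin n) λ w → Mutual G x w × low s x ≡ fin (fP w) × fP w < fP x
        F-reaches-active : ∀ x → x ∈ F s → Σ (Fin n) λ u → Active s u × Reach G x u × fP u < fP x
        done⇒∞∨F         : ∀ x → done s x ≡ true → low s x ≢ ∞ → x ∈ F s
        active-reaches-F : ∀ x → x ∈ F s → ∀ u → Active s u → fP u < fP x → Reach G u x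
        F-prefix-closed  : ∀ u → Active s u → PrefixClosed (after u) (F s)
    open ComponentInvariant

    componentInvariant-initial : ComponentInvariant (initial G)
    componentInvariant-initial = record
      { ∞⇒component-done = λ x () ; leader-done⇒∞ = λ v ℓ () ; F-low = λ x () ; F-reaches-active = λ x ()
      ; done⇒∞∨F = λ x () ; active-reaches-F = λ x () ; F-prefix-closed = λ u _ → tt }

    leader-done⇒done : ∀ {s ℓ v} → Invariant s → ComponentInvariant s → IsLeader G R ℓ v → done s ℓ ≡ true →
      done s v ≡ true
    leader-done⇒done {s} {ℓ} {v} I J il dℓ =
      ∞⇒component-done J ℓ vℓ (leader-done⇒∞ J ℓ ℓ vℓ (leader-self {R = R} il) dℓ) v (proj₁ il)
      where
      vℓ : visited s ℓ ≡ true
      vℓ = done⇒visited I ℓ dℓ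

    still-active : ∀ s v {u} → Active s u → u ≢ v → visited s u ≡ true × upd (done s) v true u ≡ false
    still-active s v {u} au u≢v = proj₁ au , trans (upd-≢ (done s) v true u u≢v) (proj₂ au)

    previsit-preserves : ∀ s tr w p → Invariant s → ComponentInvariant s → visited s w ≡ false →
      PreIsFinal s → fP w ≡ suc (counter s) → ComponentInvariant (previsit G (record s { traversed = tr }) w p)
    previsit-preserves s tr w p I J nw fP≡ fPw = record
      { ∞⇒component-done = ∞⇒component-done' ; leader-done⇒∞ = leader-done⇒∞'
      ; F-low = λ x x∈ → F-low' x x∈ (F-low J x x∈)
      ; F-reaches-active = λ x x∈ → F-reaches-active' (F-reaches-active J x x∈)
      ; done⇒∞∨F = λ x d lx →
          done⇒∞∨F J x d (λ e → lx (trans (upd-≢ (low s) w _ x (visited≢w x (done⇒visited I x d))) e))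
      ; active-reaches-F = active-reaches-F' ; F-prefix-closed = F-prefix-closed' }
      where
      s' : State G
      s' = previsit G (record s { traversed = tr }) w p
      visited≢w : ∀ x → visited s x ≡ true → x ≢ w
      visited≢w x vx refl = true≢false (trans (sym vx) nw)
      F<w : ∀ x → x ∈ F s → fP x < fP w
      F<w x x∈ = subst₂ _<_ (sym (fP≡ x (F⇒visited I x x∈))) (sym fPw)
                           (s≤s (pre≤counter I x (F⇒visited I x x∈)))
      ∞⇒component-done' : ∀ x → visited s' x ≡ true → low s' x ≡ ∞ → ∀ y → Mutual G x y → done s y ≡ true
      ∞⇒component-done' x vx lx with x ≟ w
      ... | yes refl = ⊥-elim (∞≢fin (sym lx))
      ... | no _ = ∞⇒component-done J x vx lx
      leader-done⇒∞' : ∀ v ℓ → visited s' v ≡ true → IsLeader G R ℓ v → done s ℓ ≡ true → low s' v ≡ ∞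
      leader-done⇒∞' v ℓ vv il dℓ with v ≟ w
      ... | yes refl = ⊥-elim (true≢false (trans (sym (done⇒visited I v (leader-done⇒done I J il dℓ))) nw))
      ... | no _ = leader-done⇒∞ J v ℓ vv il dℓ
      F-low' : ∀ x → x ∈ F s → (Σ (Fin n) λ u → Mutual G x u × low s x ≡ fin (fP u) × fP u < fP x) →
        Σ (Fin n) λ u → Mutual G x u × low s' x ≡ fin (fP u) × fP u < fP x
      F-low' x x∈ (u , xu , lx , u<x) =
        u , xu , trans (upd-≢ (low s) w _ x (visited≢w x (F⇒visited I x x∈))) lx , u<x
      F-reaches-active' : ∀ {x} → (Σ (Fin n) λ u → Active s u × Reach G x u × fP u < fP x) →
        Σ (Fin n) λ u → Active s' u × Reach G x u × fP u < fP x
      F-reaches-active' (u , (vu , du) , xu , u<x) = u , (upd-keeps-true (visited s) w u vu , du) , xu , u<x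
      active-reaches-F' : ∀ x → x ∈ F s → ∀ u → Active s' u → fP u < fP x → Reach G u x
      active-reaches-F' x x∈ u au u<x with u ≟ w
      ... | yes refl = ⊥-elim (<-asym u<x (F<w x x∈))
      ... | no _ = active-reaches-F J x x∈ u au u<x
      F-prefix-closed' : ∀ u → Active s' u → PrefixClosed (after u) (F s)
      F-prefix-closed' u au with u ≟ w
      ... | yes refl = all-false⇒PrefixClosed (F s) (All.tabulate (λ x∈ → <ᵇ-false (<⇒≤ (F<w _ x∈))))
      ... | no _ = F-prefix-closed J u au

    set-active-low : ∀ {s} p k tr c → ComponentInvariant s → Active s p → ¬ (p ∈ F s) → low s p ≢ ∞ → k ≢ ∞ →
      ComponentInvariant (record s { low = upd (low s) p k ; traversed = tr ; current = c })
    set-active-low {s} p k tr c J ap p∉F lp k≢∞ = record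
      { ∞⇒component-done = ∞⇒component-done' ; leader-done⇒∞ = leader-done⇒∞'
      ; F-low = F-low' ; F-reaches-active = F-reaches-active J ; done⇒∞∨F = done⇒∞∨F'
      ; active-reaches-F = active-reaches-F J ; F-prefix-closed = F-prefix-closed J }
      where
      L' : Fin n → Low
      L' = upd (low s) p k
      ∞⇒component-done' : ∀ x → visited s x ≡ true → L' x ≡ ∞ → ∀ y → Mutual G x y → done s y ≡ true
      ∞⇒component-done' x vx lx with x ≟ p
      ... | yes refl = ⊥-elim (k≢∞ lx)
      ... | no _ = ∞⇒component-done J x vx lx
      leader-done⇒∞' : ∀ v ℓ → visited s v ≡ true → IsLeader G R ℓ v → done s ℓ ≡ true → L' v ≡ ∞
      leader-done⇒∞' v ℓ vv il dℓ with v ≟ p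
      ... | yes refl = ⊥-elim (lp (leader-done⇒∞ J v ℓ vv il dℓ))
      ... | no _ = leader-done⇒∞ J v ℓ vv il dℓ
      F-low' : ∀ x → x ∈ F s → Σ (Fin n) λ w → Mutual G x w × L' x ≡ fin (fP w) × fP w < fP x
      F-low' x x∈ with F-low J x x∈
      ... | w , xw , lx , w<x = w , xw , trans (upd-≢ (low s) p k x (λ { refl → p∉F x∈ })) lx , w<x
      done⇒∞∨F' : ∀ x → done s x ≡ true → L' x ≢ ∞ → x ∈ F s
      done⇒∞∨F' x d lx with x ≟ p
      ... | yes refl = ⊥-elim (true≢false (trans (sym d) (proj₂ ap)))
      ... | no _ = done⇒∞∨F J x d lx

    RetReach-refl : ∀ v → RetReach G R v v
    RetReach-refl v = [] , [] , [] , [] , [] , []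

    pushed-low : ∀ {s v} → Invariant s → current s ≡ just v → PreIsFinal s →
      CorrectLow G R v (low s v) → eqLP (low s v) (pre s v) ≡ false →
      Σ (Fin n) λ w → Mutual G v w × low s v ≡ fin (fP w) × fP w < fP v
    pushed-low {s} {v} I c≡ fP≡ (k , lk , (w , (_ , path , inComponent , _) , fPw≡k) , minimal) ne =
      w , [ (λ { refl → ⊥-elim (<-irrefl refl w<v) }) , (λ v-w → v-w) ]′ (Path-in-component path inComponent) ,
      trans lk (cong fin (sym fPw≡k)) , w<v
      where
      k≢pre : k ≢ fP v
      k≢pre k≡ = eqLP-false⇒≢ k (pre s v) (subst (λ l → eqLP l (pre s v) ≡ false) lk ne)
                   (trans k≡ (fP≡ v (proj₁ (current-active I c≡))))
      w<v : fP w < fP v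
      w<v = subst (_< fP v) (sym fPw≡k) (≤∧≢⇒< (minimal v (RetReach-refl v)) k≢pre)

    active-below-in-reach : ∀ {s v w} → Invariant s → ComponentInvariant s → current s ≡ just v →
      VisitedDownClosed s → Mutual G v w → fP w < fP v → Σ (Fin n) λ u → Active s u × Reach G v u × fP u < fP v
    active-below-in-reach {s} {v} {w} I J c≡ down v-w w<v with done s w in dw
    ... | false = w , (vw , dw) , proj₁ v-w , w<v
      where
      vw : visited s w ≡ true
      vw = down v w (proj₁ (current-active I c≡)) (<⇒≤ w<v)
    ... | true = via-F (F-reaches-active J w (done⇒∞∨F J w dw lw))
      where
      lw : low s w ≢ ∞
      lw l = true≢false (trans (sym (∞⇒component-done J w (done⇒visited I w dw) l v (Mutual-sym v-w)))
                              (proj₂ (current-active I c≡)))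
      via-F : (Σ (Fin n) λ u → Active s u × Reach G w u × fP u < fP w) →
        Σ (Fin n) λ u → Active s u × Reach G v u × fP u < fP v
      via-F (u , au , w⇝u , u<w) = u , au , Reach-trans (proj₁ v-w) w⇝u , <-trans u<w w<v

    -- At a push, v's low value names an earlier vertex of its component, and through it v reaches an
    -- active vertex below v.
    module Push {s v} (I : Invariant s) (J : ComponentInvariant s) (c≡ : current s ≡ just v)
                (fP≡ : PreIsFinal s) (down : VisitedDownClosed s)
                (correct : CorrectLow G R v (low s v)) (ne : eqLP (low s v) (pre s v) ≡ false) where
      witness : Σ (Fin n) λ w → Mutual G v w × low s v ≡ fin (fP w) × fP w < fP v
      witness = pushed-low I c≡ fP≡ correct ne

      target : Σ (Fin n) λ u → Active s u × Reach G v u × fP u < fP v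
      target = active-below-in-reach I J c≡ down (proj₁ (proj₂ witness)) (proj₂ (proj₂ (proj₂ witness)))

      target-active : ∀ x → fP v ≤ fP x →
        Σ (Fin n) λ u → (visited s u ≡ true × upd (done s) v true u ≡ false) × Reach G v u × fP u < fP x
      target-active x v≤x with target
      ... | u , au , v⇝u , u<v =
        u , still-active s v au (λ u≡v → <-irrefl (cong fP u≡v) u<v) , v⇝u , <-≤-trans u<v v≤x

      leader-done⇒∞' : ∀ v' ℓ → visited s v' ≡ true → IsLeader G R ℓ v' → upd (done s) v true ℓ ≡ true →
        low s v' ≡ ∞
      leader-done⇒∞' v' ℓ vv il dℓ with ℓ ≟ v | witness
      ... | yes refl | w , v-w , _ , w<v = ⊥-elim (<⇒≱ w<v (proj₂ il w (Mutual-trans (Mutual-sym v-w) (proj₁ il))))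
      ... | no _ | _ = leader-done⇒∞ J v' ℓ vv il dℓ

      F-reaches-active' : ∀ x → x ∈ v ∷ F s → Σ (Fin n) λ u → Active (push s v) u × Reach G x u × fP u < fP x
      F-reaches-active' x (Any.here refl) = target-active v ≤-refl
      F-reaches-active' x (Any.there x∈) with F-reaches-active J x x∈
      ... | u , au , x⇝u , u<x with u ≟ v
      ...   | no u≢v = u , still-active s v au u≢v , x⇝u , u<x
      ...   | yes refl with target-active x (<⇒≤ u<x)
      ...     | u' , au' , v⇝u' , u'<x = u' , au' , Reach-trans x⇝u v⇝u' , u'<x

      done⇒∞∨F' : ∀ x → upd (done s) v true x ≡ true → low s x ≢ ∞ → x ∈ v ∷ F s
      done⇒∞∨F' x d lx with x ≟ v
      ... | yes refl = Any.here refl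
      ... | no _ = Any.there (done⇒∞∨F J x d lx)

      active-reaches-F' : ∀ x → x ∈ v ∷ F s → ∀ u → Active (push s v) u → fP u < fP x → Reach G u x
      active-reaches-F' x (Any.here refl) u au _ = active-reaches-current I c≡ (proj₂ (active-after-finish s v u au))
      active-reaches-F' x (Any.there x∈) u au = active-reaches-F J x x∈ u (proj₂ (active-after-finish s v u au))

      F-prefix-closed' : ∀ u → Active (push s v) u → PrefixClosed (after u) (v ∷ F s)
      F-prefix-closed' u au with active-after-finish s v u au
      ... | u≢v , au' =
        (λ f → ⊥-elim (true≢false (trans (sym (<ᵇ-true (active-fP<current I fP≡ c≡ au' u≢v))) f))) ,
        F-prefix-closed J u au'

      push-preserves : ∀ c → ComponentInvariant (record (push s v) { current = c })
      push-preserves c = record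
        { ∞⇒component-done = λ x vx lx y xy → upd-keeps-true (done s) v y (∞⇒component-done J x vx lx y xy)
        ; leader-done⇒∞ = leader-done⇒∞'
        ; F-low = λ { x (Any.here refl) → witness ; x (Any.there x∈) → F-low J x x∈ }
        ; F-reaches-active = F-reaches-active' ; done⇒∞∨F = done⇒∞∨F'
        ; active-reaches-F = active-reaches-F' ; F-prefix-closed = F-prefix-closed' }

    -- At a report v leads its component, and the unreported vertices of the component are exactly
    -- the vertices of F visited after v, which form a prefix of F and are popped.
    module Report {s v} (I : Invariant s) (J : ComponentInvariant s) (c≡ : current s ≡ just v)
                  (ae : AllExitTraversed G s v) (fP≡ : PreIsFinal s)
                  (leader : ∀ w → Mutual G v w → fP v ≤ fP w) (low≡ : low s v ≡ fin (fP v)) where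
      vact : Active s v
      vact = current-active I c≡

      component-finished : ∀ y → Mutual G v y → y ≡ v ⊎ done s y ≡ true
      component-finished y v-y with Above? I v y
      ... | yes above-y = above-finished I c≡ above-y
      ... | no ¬above-y = ⊥-elim (no-exit (exit-below I c≡ ae (proj₁ vact , ≤-refl) ¬above-y (proj₁ v-y)))
        where
        no-exit : ¬ ExitArc I v v y
        no-exit (b , _ , tb , hd<v , v⇝tl , hd⇝y) =
          <⇒≱ hd<v (subst₂ _≤_ (fP≡ v (proj₁ vact)) (fP≡ (hd b) (traversed⇒visited I b tb))
                      (leader (hd b) (Reach-trans v⇝tl (there b refl here) , Reach-trans hd⇝y (proj₂ v-y))))

      component-done : ∀ y → Mutual G v y → upd (done s) v true y ≡ true
      component-done y v-y with component-finished y v-y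
      ... | inj₁ refl = upd-≡ (done s) y true
      ... | inj₂ d = upd-keeps-true (done s) v y d

      F-after-in-component : ∀ x → x ∈ F s → fP v < fP x → Mutual G v x
      F-after-in-component x x∈ v<x with F-reaches-active J x x∈
      ... | u , au , x⇝u , _ = active-reaches-F J x x∈ v vact v<x , Reach-trans x⇝u (active-reaches-current I c≡ au)

      agrees : Agrees (after v) (low s v) (low s) (F s)
      agrees x x∈ with F-low J x x∈
      ... | w , x-w , lx , w<x = subst₂ (λ a b → geqL a b ≡ after v x) (sym lx) (sym low≡)
        (geqL-fin (fP w) (fP v) (fP x) (λ v≤w → ≤-<-trans v≤w w<x)
                                       (λ v<x → leader w (Mutual-trans (F-after-in-component x x∈ v<x) x-w)))

      pop : (Fin n → Low) × List (Fin n)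
      pop = popLoop G (low s) (low s v) (F s)

      L' : Fin n → Low
      L' = upd (proj₁ pop) v ∞

      popped : ∀ x → x ∈ F s → after v x ≡ true → proj₁ pop x ≡ ∞
      popped = popLoop-pops (after v) (low s v) (low s) (F s) agrees (F-prefix-closed J v vact)

      kept : ∀ x → x ∈ F s → after v x ≡ false → x ∈ proj₂ pop
      kept = popLoop-keeps (after v) (low s v) (low s) (F s) agrees

      rest : ∀ x → x ∈ proj₂ pop → x ∈ F s × after v x ≡ false
      rest x x∈ = popLoop-rest⊆ (low s) (low s v) (F s) x∈ ,
                  popLoop-rest (after v) (low s v) (low s) (F s) agrees (F-prefix-closed J v vact) x x∈

      rest-low : ∀ x → x ∈ proj₂ pop → L' x ≡ low s x
      rest-low x x∈ with x ≟ v | popLoop-low (after v) (low s v) (low s) (F s) agrees x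
      ... | yes refl | _ = ⊥-elim (active∉F I vact (proj₁ (rest x x∈)))
      ... | no _ | inj₁ e = e
      ... | no _ | inj₂ (_ , px) = ⊥-elim (true≢false (trans (sym px) (proj₂ (rest x x∈))))

      ∞-stays : ∀ x → low s x ≡ ∞ → L' x ≡ ∞
      ∞-stays x lx with x ≟ v
      ... | yes _ = refl
      ... | no _ = popLoop-∞ (low s) (low s v) (F s) x lx

      component-popped : ∀ x → visited s x ≡ true → Mutual G v x → L' x ≡ ∞
      component-popped x vx v-x with x ≟ v | low s x in lx | component-finished x v-x
      ... | yes _ | _ | _ = refl
      ... | no x≢v | _ | inj₁ x≡v = ⊥-elim (x≢v x≡v)
      ... | no _ | ∞ | inj₂ _ = popLoop-∞ (low s) (low s v) (F s) x lx
      ... | no x≢v | fin k | inj₂ dx = popped x (done⇒∞∨F J x dx (λ e → ∞≢fin (trans (sym e) lx)))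
          (<ᵇ-true (≤∧≢⇒< (leader x v-x) (λ e → x≢v (sym (fP-injective I fP≡ (proj₁ vact) vx e)))))

      ∞⇒component-done' : ∀ x → visited s x ≡ true → L' x ≡ ∞ →
        ∀ y → Mutual G x y → upd (done s) v true y ≡ true
      ∞⇒component-done' x vx lx y x-y with x ≟ v
      ... | yes refl = component-done y x-y
      ... | no _ with popLoop-low (after v) (low s v) (low s) (F s) agrees x
      ...   | inj₁ e = upd-keeps-true (done s) v y (∞⇒component-done J x vx (trans (sym e) lx) y x-y)
      ...   | inj₂ (x∈ , px) = component-done y (Mutual-trans (F-after-in-component x x∈ (<ᵇ-true⇒< px)) x-y)

      leader-done⇒∞' : ∀ v' ℓ → visited s v' ≡ true → IsLeader G R ℓ v' → upd (done s) v true ℓ ≡ true →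
        L' v' ≡ ∞
      leader-done⇒∞' v' ℓ vv il dℓ with ℓ ≟ v
      ... | yes refl = component-popped v' vv (proj₁ il)
      ... | no _ = ∞-stays v' (leader-done⇒∞ J v' ℓ vv il dℓ)

      F-low' : ∀ x → x ∈ proj₂ pop → Σ (Fin n) λ w → Mutual G x w × L' x ≡ fin (fP w) × fP w < fP x
      F-low' x x∈ with F-low J x (proj₁ (rest x x∈))
      ... | w , x-w , lx , w<x = w , x-w , trans (rest-low x x∈) lx , w<x

      F-reaches-active' : ∀ x → x ∈ proj₂ pop →
        Σ (Fin n) λ u → Active (report s v) u × Reach G x u × fP u < fP x
      F-reaches-active' x x∈ with F-reaches-active J x (proj₁ (rest x x∈))
      ... | u , au , x⇝u , u<x = u , still-active s v au u≢v , x⇝u , u<x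
        where
        u≢v : u ≢ v
        u≢v refl = true≢false (trans (sym (<ᵇ-true u<x)) (proj₂ (rest x x∈)))

      done⇒∞∨F' : ∀ x → upd (done s) v true x ≡ true → L' x ≢ ∞ → x ∈ proj₂ pop
      done⇒∞∨F' x d lx with x ≟ v
      ... | yes refl = ⊥-elim (lx refl)
      ... | no _ with done⇒∞∨F J x d (λ e → lx (popLoop-∞ (low s) (low s v) (F s) x e)) | after v x in px
      ...   | x∈ | true = ⊥-elim (lx (popped x x∈ px))
      ...   | x∈ | false = kept x x∈ px

      report-preserves : ∀ c → ComponentInvariant (record (report s v) { current = c })
      report-preserves c = record
        { ∞⇒component-done = ∞⇒component-done' ; leader-done⇒∞ = leader-done⇒∞'
        ; F-low = F-low' ; F-reaches-active = F-reaches-active' ; done⇒∞∨F = done⇒∞∨F'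
        ; active-reaches-F = λ x x∈ u au →
            active-reaches-F J x (proj₁ (rest x x∈)) u (proj₂ (active-after-finish s v u au))
        ; F-prefix-closed = λ u au → PrefixClosed-popLoop (after u) (low s) (low s v) (F s)
                                      (F-prefix-closed J u (proj₂ (active-after-finish s v u au))) }

    record StepFacts (s : State G) (l : Label G) (s' : State G) : Set where
      field
        finalPre≡         : PreIsFinal s
        finalPre≡'        : PreIsFinal s'
        visitedDownClosed : VisitedDownClosed s
        lowCorrect        : ∀ v → Postvisits G l v → CorrectLow G R v (low s v)
        isLeader          : ∀ v → Postvisits G l v → low s v ≡ fin (fP v) → ∀ w → Mutual G v w → fP v ≤ fP w
    open StepFacts

    report-low≡fP : ∀ {s l s' v} → Invariant s → current s ≡ just v → StepFacts s l s' →
      eqLP (low s v) (pre s v) ≡ true → low s v ≡ fin (fP v)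
    report-low≡fP {s} {v = v} I c≡ C e =
      trans (eqLP⇒≡fin (low s v) (pre s v) e) (cong fin (sym (finalPre≡ C v (proj₁ (current-active I c≡)))))

    returnAlong-preserves : ∀ {v a} t → Invariant (returnAlong t v a) → low t (tl a) ≢ ∞ →
      ComponentInvariant t → ComponentInvariant (returnAlong t v a)
    returnAlong-preserves {v} {a} t I' ltl J =
      set-active-low (tl a) _ (traversed t) (just (tl a)) J atl (active∉F I' atl) ltl
        (minL-finite (low t (tl a)) (low t v) ltl)
      where
      atl : Active t (tl a)
      atl = current-active I' refl

    parent-finite : ∀ {s v a} → Invariant s → current s ≡ just v → parent s v ≡ just a → low s (tl a) ≢ ∞
    parent-finite {a = a} I c≡ p = finite⇒≢∞ (proj₂ (active⇒finite I (tl a) (proj₁ (parent-active I c≡ p))))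

    component-step : ∀ {s l s'} → Invariant s → Invariant s' → StepView s l s' → StepFacts s l s' →
      ComponentInvariant s → ComponentInvariant s'
    component-step {s} I I' (rootStep v _ nv) C J =
      previsit-preserves s (traversed s) v nothing I J nv (finalPre≡ C)
        (trans (finalPre≡' C v (upd-≡ (visited s) v true)) (upd-≡ (pre s) v _))
    component-step {s} I I' (treeStep a _ _ nv) C J =
      previsit-preserves s (upd (traversed s) a true) (hd a) (just a) I J nv (finalPre≡ C)
        (trans (finalPre≡' C (hd a) (upd-≡ (visited s) (hd a) true)) (upd-≡ (pre s) (hd a) _))
    component-step {s} I I' (nontreeStep a c≡ _ _) C J =
      set-active-low (tl a) _ (upd (traversed s) a true) (current s) J atl (active∉F I atl) ltl
        (minL-finite (low s (tl a)) (low s (hd a)) ltl)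
      where
      atl : Active s (tl a)
      atl = current-active I c≡
      ltl : low s (tl a) ≢ ∞
      ltl = finite⇒≢∞ (proj₂ (active⇒finite I (tl a) atl))
    component-step {s} I I' (rootReport v c≡ ae _ e) C J =
      Report.report-preserves I J c≡ ae (finalPre≡ C) (isLeader C v refl low≡) low≡ nothing
      where
      low≡ : low s v ≡ fin (fP v)
      low≡ = report-low≡fP I c≡ C e
    component-step I I' (rootPush v c≡ _ _ e) C J =
      Push.push-preserves I J c≡ (finalPre≡ C) (visitedDownClosed C) (lowCorrect C v refl) e nothing
    component-step {s} I I' (childReport v a c≡ ae p e) C J =
      returnAlong-preserves (report s v) I'
        (λ l∞ → parent-finite I c≡ p
                  (trans (sym (report-active-low s v (tl a) I (proj₁ tl-active) (proj₂ tl-active))) l∞))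
        (Report.report-preserves I J c≡ ae (finalPre≡ C) (isLeader C v refl low≡) low≡ (current s))
      where
      low≡ : low s v ≡ fin (fP v)
      low≡ = report-low≡fP I c≡ C e
      tl-active : Active s (tl a) × tl a ≢ v
      tl-active = parent-active I c≡ p
    component-step {s} I I' (childPush v a c≡ ae p e) C J =
      returnAlong-preserves (push s v) I' (parent-finite I c≡ p)
        (Push.push-preserves I J c≡ (finalPre≡ C) (visitedDownClosed C) (lowCorrect C v refl) e (current s))

    module _ (H : LowCorrectAtPostvisits G R) where
      step-facts : ∀ i → (i<L : i < len R) → StepFacts (at i) (lbl R i) (at (suc i))
      step-facts i i<L = record
        { finalPre≡ = preIsFinal i (<⇒≤ i<L) ; finalPre≡' = preIsFinal (suc i) i<L
        ; visitedDownClosed = visited-downClosed i (<⇒≤ i<L) ; lowCorrect = H i i<L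
        ; isLeader = λ v pv → let (c≡ , ae) = postvisit-label (view i i<L) pv
                              in low≡pre⇒leader i<L c≡ ae (H i i<L v pv) }

      componentInvariant : ∀ i → i ≤ len R → ComponentInvariant (at i)
      componentInvariant zero _ = subst ComponentInvariant (sym (start R)) componentInvariant-initial
      componentInvariant (suc i) i<L = component-step (invariant i (<⇒≤ i<L)) (invariant (suc i) i<L)
        (view i i<L) (step-facts i i<L) (componentInvariant i (<⇒≤ i<L))

lemma14 : (G : Graph) (R : Run G) → LowCorrectAtPostvisits G R →
    ∀ i → i ≤ len R → ∀ v → visited (st R i) v ≡ true →
    ∀ ℓ → IsLeader G R ℓ v →
    (low (st R i) v ≡ ∞ ⇔ done (st R i) ℓ ≡ true)
lemma14 G R H i i≤L v vv ℓ il =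
  mk⇔ (λ low≡∞ → ∞⇒component-done v vv low≡∞ ℓ (Mutual-sym (proj₁ il))) (leader-done⇒∞ v ℓ vv il)
  where
  open Exploration.OnRun G R
  open ComponentInvariant (componentInvariant H i i≤L)
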